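{- Let $1\le k\le w$ be integers, and let $(X,P)$ be the poset constructed by Anna's strategy $R(k,w)$ against an arbitrary on-line chain partitioning algorithm. Then $X$ contains a sequence of chains $C_1,\ldots,C_w$ that has the Rainbow Property.
   Context: Game: in each round Anna introduces a new point, and Bertha (an on-line algorithm) irrevocably gives it a color so that each color class is a chain of the poset; $c(x)$ denotes the color of $x$. Algorithm $L_\alpha(k,w)$, for positive integers $k\le w$, places the points of one "call" into a linear order $L_\alpha$, within the interval of $L_\alpha$ that the call is assigned. It is defined recursively on $w$ and has two stages. - Stage 1. Each round a new point $x$ is introduced. If $k<w$, $x$ is placed above all previous Stage-1 points of the call. If $k=w$, Anna traverses the Stage-1 points of the call upward. She inserts $x$ immediately below the first such point $y$ for which some Stage-1 point $z$ of the call with $z<y$ has $c(z)=c(y)$; if there is no such $y$, $x$ is placed on top. Stage 1 ends once the Stage-1 points of the call have received $w$ distinct colors. Let $x_N$ be the last Stage-1 point. - Stage 2. If $k<w$, Anna plays $L_\alpha(k,w-1)$ entirely below all Stage-1 points of the call. If $k=w$, she plays $L_\alpha(w-1,w-1)$ entirely above $x_N$ and below the Stage-1 points of the call lying above $x_N$ (if any). - For $w=1$, a single point is introduced. Algorithm $L_\beta(k,w)$ is defined analogously with the roles swapped. - Stage 1. If $k<w$, the new point is inserted by the traversal rule above. If $k=w$, it is placed on top of the Stage-1 points of the call. Stage 1 ends in the same way. - Stage 2. If $k<w$, Anna plays $L_\beta(k,w-1)$ entirely above $x_N$ and below the Stage-1 points above $x_N$. If $k=w$, she plays $L_\beta(w-1,w-1)$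 entirely below all Stage-1 points. Strategy $R(k,w)$: Anna places each new point simultaneously into two linear orders $L_\alpha$ and $L_\beta$, according to $L_\alpha(k,w)$ and $L_\beta(k,w)$. The poset presented is $P=L_\alpha\cap L_\beta$. Rainbow Property: a sequence of chains $C_1,\ldots,C_w$ in $(X,P)$ has it if all of the following hold. 1. Points in different $C_i$ are incomparable in $P$. 2. Distinct points of $\bigcup_i C_i$ have distinct colors. 3. $|C_i|=i$ for each $1\le i\le w$. 4. $\bigcup_i C_i$ is a down-set: if $x\in\bigcup_i C_i$ and $y<x$ in $P$, then $y\in\bigcup_i C_i$. -}

module Defs where

open import Data.Nat using (ℕ; zero; suc; _<_; _∸_; _≡ᵇ_; _<ᵇ_; _≤ᵇ_)
open import Data.Nat.Properties using (_≟_)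
open import Data.Bool using (Bool; true; false; _∧_; if_then_else_)
open import Data.List using (List; []; _∷_; _++_; map; length; deduplicate)
open import Data.Bool.ListAction using (any)
open import Data.List.Membership.Propositional using (_∈_)
open import Data.List.Relation.Unary.Unique.Propositional using (Unique)
open import Data.Fin using (Fin; toℕ; inject≤)
open import Data.Fin.Properties using (toℕ<n)
open import Data.Vec using (Vec; lookup; tabulate)
open import Data.Maybe using (Maybe; just; nothing)
import Data.Maybe
open import Data.Product using (_×_; _,_; Σ; ∃)
open import Data.Sum using (_⊎_)
open import Relation.Binary.PropositionalEquality using (_≡_; _≢_)

-- A finite poset whose points 0,…,n-1 are listed in order of
-- introduction is given by its strict order relation as a Boolean
-- adjacency matrix.  An on-line algorithm, when point m is introduced,
-- sees the poset induced on the points 0,…,m and outputs the colour of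
-- point m.

Matrix : ℕ → Set
Matrix n = Vec (Vec Bool n) n

rel : ∀ {n} → Matrix n → Fin n → Fin n → Bool
rel M a b = lookup (lookup M a) b

OnlineAlg : Set
OnlineAlg = (m : ℕ) → Matrix (suc m) → ℕ

restrictM : ∀ {n} → Matrix n → (i : Fin n) → Matrix (suc (toℕ i))
restrictM M i =
  tabulate λ a → tabulate λ b → rel M (inject≤ a (toℕ<n i)) (inject≤ b (toℕ<n i))

colorM : OnlineAlg → ∀ {n} → Matrix n → Fin n → ℕ
colorM B M i = B (toℕ i) (restrictM M i)

IsStrictPO : ∀ {n} → Matrix n → Set
IsStrictPO M =
  (∀ a → rel M a a ≡ false) ×
  (∀ a b c → rel M a b ≡ true → rel M b c ≡ true → rel M a c ≡ true)

IsChainPartitioner : OnlineAlg → Set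
IsChainPartitioner B =
  ∀ n (M : Matrix n) → IsStrictPO M → ∀ i j → i ≢ j →
  colorM B M i ≡ colorM B M j → rel M i j ≡ true ⊎ rel M j i ≡ true

-- Linear orders as lists (bottom to top), poset P = L_α ∩ L_β

elem : ℕ → List ℕ → Bool
elem y zs = any (y ≡ᵇ_) zs

before : List ℕ → ℕ → ℕ → Bool
before [] x y = false
before (z ∷ zs) x y =
  if z ≡ᵇ x then elem y zs else (if z ≡ᵇ y then false else before zs x y)

ltB : List ℕ → List ℕ → ℕ → ℕ → Bool
ltB α β x y = before α x y ∧ before β x y

posetMatrix : List ℕ → List ℕ → (m : ℕ) → Matrix m
posetMatrix α β m = tabulate λ a → tabulate λ b → ltB α β (toℕ a) (toℕ b)

colorAt : OnlineAlg → List ℕ → List ℕ → ℕ → ℕ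
colorAt B α β x = B x (posetMatrix α β (suc x))

-- a call occupies a contiguous block of both lists:
-- L_α = preα ++ block ++ sufα,  L_β = preβ ++ block ++ sufβ
record Ctx : Set where
  constructor ctx
  field
    preα sufα preβ sufβ : List ℕ
open Ctx public

insertBeforeFirst : (ℕ → Bool) → ℕ → List ℕ → List ℕ
insertBeforeFirst p x [] = x ∷ []
insertBeforeFirst p x (y ∷ ys) = if p y then x ∷ y ∷ ys else y ∷ insertBeforeFirst p x ys

splitAfter : ℕ → List ℕ → List ℕ × List ℕ
splitAfter x [] = [] , []
splitAfter x (y ∷ ys) with y ≡ᵇ x
... | true = y ∷ [] , ys
... | false with splitAfter x ys
...   | a , b = y ∷ a , b

countDistinct : List ℕ → ℕ
countDistinct l = length (deduplicate _≟_ l)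

-- Stage 1 of a call with parameters (k,w); Sα, Sβ are the Stage-1
-- points so far in the order of L_α, L_β; m is the index of the next new
-- point.  Returns the Stage-1 blocks, the next index and x_N.
-- (fuel bounds the number of rounds; nothing = out of fuel)
stage1 : OnlineAlg → (fuel k w : ℕ) → Ctx → (Sα Sβ : List ℕ) → ℕ →
         Maybe (List ℕ × List ℕ × ℕ × ℕ)
stage1 B zero k w C Sα Sβ m = nothing
stage1 B (suc f) k w C Sα Sβ m =
  let gα = preα C ++ Sα ++ sufα C
      gβ = preβ C ++ Sβ ++ sufβ C
      c = colorAt B gα gβ
      -- y is a point where the traversal stops: some Stage-1 z < y in P
      -- has the same colour as y
      bad : ℕ → Bool
      bad y = any (λ z → ltB gα gβ z y ∧ (c z ≡ᵇ c y)) Sα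
      Sα' = if k <ᵇ w then Sα ++ m ∷ [] else insertBeforeFirst bad m Sα
      Sβ' = if k <ᵇ w then insertBeforeFirst bad m Sβ else Sβ ++ m ∷ []
      c' = colorAt B (preα C ++ Sα' ++ sufα C) (preβ C ++ Sβ' ++ sufβ C)
  in if w ≤ᵇ countDistinct (map c' Sα')
     then just (Sα' , Sβ' , suc m , m)
     else stage1 B f k w C Sα' Sβ' (suc m)

-- Stage 2 of a call with parameters (k,w), w ≥ 2, given the Stage-1
-- result; `rec k' C' m'` plays the recursive call with parameters
-- (k', w-1) in context C' starting with point index m'.
stage2 : (k w : ℕ) → Ctx → List ℕ × List ℕ × ℕ × ℕ →
         (ℕ → Ctx → ℕ → Maybe (List ℕ × List ℕ × ℕ)) →
         Maybe (List ℕ × List ℕ × ℕ)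
stage2 k w C (Sα , Sβ , m' , xN) rec with splitAfter xN Sα | splitAfter xN Sβ | k <ᵇ w
... | Aα , Bα | Aβ , Bβ | true =
  -- k < w : L_α(k,w-1) below all Stage-1 points in L_α,
  --         L_β(k,w-1) just above x_N in L_β
  Data.Maybe.map (λ { (cα , cβ , m'') → cα ++ Sα , Aβ ++ cβ ++ Bβ , m'' })
    (rec k (ctx (preα C) (Sα ++ sufα C) (preβ C ++ Aβ) (Bβ ++ sufβ C)) m')
... | Aα , Bα | Aβ , Bβ | false =
  -- k = w : L_α(w-1,w-1) just above x_N in L_α,
  --         L_β(w-1,w-1) below all Stage-1 points in L_β
  Data.Maybe.map (λ { (cα , cβ , m'') → Aα ++ cα ++ Bα , cβ ++ Sβ , m'' })
    (rec (w ∸ 1) (ctx (preα C ++ Aα) (Bα ++ sufα C) (preβ C) (Sβ ++ sufβ C)) m')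

-- a whole call of L_α(k,w) / L_β(k,w) played simultaneously;
-- returns the final blocks of the call in L_α and L_β and the next index
call : OnlineAlg → (fuel k w : ℕ) → Ctx → ℕ → Maybe (List ℕ × List ℕ × ℕ)
call B f k zero C m = nothing
call B f k (suc zero) C m = just (m ∷ [] , m ∷ [] , suc m)
call B f k (suc (suc w)) C m =
  Data.Maybe._>>=_ (stage1 B f k (suc (suc w)) C [] [] m) λ r →
    stage2 k (suc (suc w)) C r (λ k' C' m' → call B f k' (suc w) C' m')

-- R(k,w): final (L_α , L_β , number of points n); points are 0,…,n-1
R : OnlineAlg → (fuel k w : ℕ) → Maybe (List ℕ × List ℕ × ℕ)
R B f k w = call B f k w (ctx [] [] [] []) 0

LtP : List ℕ → List ℕ → ℕ → ℕ → Set
LtP α β x y = ltB α β x y ≡ true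

Incomparable : List ℕ → List ℕ → ℕ → ℕ → Set
Incomparable α β x y = x ≢ y × ltB α β x y ≡ false × ltB α β y x ≡ false

-- C i is the chain C_{i+1}
Rainbow : OnlineAlg → List ℕ → List ℕ → (n w : ℕ) → Set
Rainbow B α β n w = Σ (Fin w → List ℕ) λ C →
  (∀ i x → x ∈ C i → x < n) ×
  (∀ i x y → x ∈ C i → y ∈ C i → x ≢ y → LtP α β x y ⊎ LtP α β y x) ×
  (∀ i j x y → i ≢ j → x ∈ C i → y ∈ C j → Incomparable α β x y) ×
  (∀ i j x y → x ∈ C i → y ∈ C j → x ≢ y →
     colorAt B α β x ≢ colorAt B α β y) ×
  (∀ i → Unique (C i) × length (C i) ≡ suc (toℕ i)) ×
  (∀ i x y → x ∈ C i → y < n → LtP α β y x → ∃ λ j → y ∈ C j)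

-- By induction on w, every call L(k,w) leaves a rainbow C_1, …, C_w made of its own
-- points.  Stage 1 stacks its points in introduction order in one of the two linear
-- orders and inserts them by the traversal rule in the other, where they form a list
-- π ++ ρ: π is increasing in both orders (a chain) and carries one point of each colour
-- seen so far, while ρ is decreasing in the traversal order (an antichain) and its colours
-- all occur in π.  Hence the traversal inserts every new point between π and ρ, the
-- antichain ρ has distinct colours so |ρ| ≤ |π| < w, and Stage 1 stops after fewer than
-- 2w rounds with a chain A = π of w points with distinct colours, topped by x_N.  Stage 2
-- is placed above A in one order and below it in the other, so its points are
-- incomparable with A and A stays a down-set; appending A as C_w to the rainbow of the
-- recursive call gives a rainbow, since an on-line chain partition colours incomparable
-- points differently.  Colours never change: Bertha sees only the points introduced so
-- far, and later insertions keep their relative order.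

module Submission where

open import Defs
open import Data.Nat using (ℕ; zero; suc; _+_; _∸_; _≤_; _<_; _>_; _≡ᵇ_; _<ᵇ_; _≤ᵇ_; z≤n; s≤s)
open import Data.Nat.Properties
  using ( ≡ᵇ⇒≡; ≤ᵇ⇒≤; ≤⇒≤ᵇ; _≟_; <-cmp; ≤-refl; ≤-reflexive; ≤-trans; ≤-antisym; ≤-pred; <-irrefl; <-asym
        ; <⇒≢; >⇒≢; <⇒≤; ≤-<-trans; <-≤-trans; n≤1+n; m≤n⇒m<n∨m≡n; +-suc; +-mono-≤; +-identityʳ)
open import Data.Bool using (Bool; true; false; _∧_; if_then_else_; T)
open import Data.Bool.ListAction using (any)
open import Data.List using (List; []; _∷_; _++_; map; length; deduplicate)
open import Data.List.Properties using (++-assoc; ++-identityʳ; length-map; length-++-sucʳ)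
open import Data.List.Membership.Propositional using (_∈_; _∉_)
open import Data.List.Membership.Propositional.Properties
  using (∈-insert; ∈-++⁺ˡ; ∈-++⁺ʳ; ∈-++⁻; ∈-∃++; ∈-map⁺; ∈-map⁻; ∈-deduplicate⁺; ∈-deduplicate⁻)
open import Data.List.Relation.Unary.Any using (here; there)
open import Data.List.Relation.Unary.All as All using (All; []; _∷_)
import Data.List.Relation.Unary.All.Properties as Allₚ
open import Data.List.Relation.Unary.AllPairs as AllPairs using (AllPairs; []; _∷_)
import Data.List.Relation.Unary.AllPairs.Properties as AllPairsₚ
open import Data.List.Relation.Unary.Unique.Propositional using (Unique)
open import Data.List.Relation.Unary.Unique.Propositional.Properties using (Unique[x∷xs]⇒x∉xs)
open import Data.List.Relation.Binary.Sublist.Propositional using (_⊆_; []; _∷_; _∷ʳ_; ⊆-refl; ⊆-trans; minimum) renaming (lookup to ⊆-∈)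
open import Data.List.Relation.Binary.Sublist.Propositional.Properties using (++⁺; ++⁺ˡ; ++⁺ʳ; All-resp-⊆)
open import Data.List.Relation.Unary.Unique.DecPropositional.Properties using (deduplicate-!)
open import Data.Fin using (Fin; toℕ; fromℕ; fromℕ<; inject₁)
open import Data.Fin.Properties using (toℕ-inject≤; toℕ-fromℕ<; toℕ<n; toℕ-injective)
open import Data.Vec using (tabulate)
import Data.Vec
open import Data.Vec.Properties using (lookup∘tabulate; tabulate-cong)
open import Data.Maybe using (Maybe; just)
import Data.Maybe
open import Data.Product using (_×_; _,_; Σ; ∃; ∃₂; proj₁; proj₂)
open import Data.Sum as Sum using (_⊎_; inj₁; inj₂)
open import Data.Empty using (⊥; ⊥-elim)
open import Data.Unit using (⊤)
open import Relation.Nullary using (¬_; yes; no)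
open import Relation.Binary.Definitions using (tri<; tri≈; tri>)
open import Relation.Binary.PropositionalEquality using (_≡_; _≢_; refl; sym; trans; cong; cong₂; subst; subst₂)
open import Function using (id; _∘_)


false≢true : false ≢ true
false≢true ()

≡ᵇ-true⇒≡ : ∀ m n → (m ≡ᵇ n) ≡ true → m ≡ n
≡ᵇ-true⇒≡ m n e = ≡ᵇ⇒≡ m n (subst T (sym e) _)

≡ᵇ-refl : ∀ n → (n ≡ᵇ n) ≡ true
≡ᵇ-refl zero = refl
≡ᵇ-refl (suc n) = ≡ᵇ-refl n

≢⇒≡ᵇ-false : ∀ m n → m ≢ n → (m ≡ᵇ n) ≡ false
≢⇒≡ᵇ-false m n ne with m ≡ᵇ n in e
... | false = refl
... | true = ⊥-elim (ne (≡ᵇ-true⇒≡ m n e))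

≡ᵇ-false⇒∈-tail : ∀ {z a l} → (z ≡ᵇ a) ≡ false → a ∈ z ∷ l → a ∈ l
≡ᵇ-false⇒∈-tail {a = a} e (here refl) = ⊥-elim (false≢true (trans (sym e) (≡ᵇ-refl a)))
≡ᵇ-false⇒∈-tail e (there p) = p

elem⇒∈ : ∀ y zs → elem y zs ≡ true → y ∈ zs
elem⇒∈ y [] ()
elem⇒∈ y (z ∷ zs) e with y ≡ᵇ z in e1
... | true = here (≡ᵇ-true⇒≡ y z e1)
... | false = there (elem⇒∈ y zs e)

∈⇒elem : ∀ {y zs} → y ∈ zs → elem y zs ≡ true
∈⇒elem {y} {z ∷ zs} (here refl) rewrite ≡ᵇ-refl y = refl
∈⇒elem {y} {z ∷ zs} (there p) with y ≡ᵇ z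
... | true = refl
... | false = ∈⇒elem p

∉⇒elem-false : ∀ y zs → y ∉ zs → elem y zs ≡ false
∉⇒elem-false y zs ne with elem y zs in e
... | false = refl
... | true = ⊥-elim (ne (elem⇒∈ y zs e))

if-true : ∀ {A : Set} {b} (x y : A) → b ≡ true → (if b then x else y) ≡ x
if-true x y refl = refl

if-false : ∀ {A : Set} {b} (x y : A) → b ≡ false → (if b then x else y) ≡ y
if-false x y refl = refl

≤ᵇ-false : ∀ W n → n < W → (W ≤ᵇ n) ≡ false
≤ᵇ-false W n lt with W ≤ᵇ n in e
... | false = refl
... | true = ⊥-elim (<-irrefl refl (<-≤-trans lt (≤ᵇ⇒≤ W n (subst T (sym e) _))))

≤ᵇ-true : ∀ W n → W ≤ n → (W ≤ᵇ n) ≡ true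
≤ᵇ-true W n le with W ≤ᵇ n | ≤⇒≤ᵇ le
... | true | _ = refl

any-true : ∀ (q : ℕ → Bool) {l z} → z ∈ l → q z ≡ true → any q l ≡ true
any-true q {y ∷ l} (here refl) e rewrite e = refl
any-true q {y ∷ l} (there p) e with q y
... | true = refl
... | false = any-true q p e

any-false : ∀ (q : ℕ → Bool) l → (∀ z → z ∈ l → q z ≡ false) → any q l ≡ false
any-false q [] h = refl
any-false q (y ∷ l) h rewrite h y (here refl) = any-false q l (λ z p → h z (there p))

∈-insert⁻ : ∀ a b {x y : ℕ} → y ∈ a ++ x ∷ b → y ≡ x ⊎ y ∈ a ++ b
∈-insert⁻ a b {x} {y} p with ∈-++⁻ a p
... | inj₁ q = inj₂ (∈-++⁺ˡ q)
... | inj₂ (here e) = inj₁ e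
... | inj₂ (there q) = inj₂ (∈-++⁺ʳ a q)

∈-insert⁺ : ∀ a b {x y : ℕ} → y ∈ a ++ b → y ∈ a ++ x ∷ b
∈-insert⁺ a b p with ∈-++⁻ a p
... | inj₁ q = ∈-++⁺ˡ q
... | inj₂ q = ∈-++⁺ʳ a (there q)

∈-remove : ∀ a b {x y : ℕ} → x ∈ a ++ y ∷ b → x ≢ y → x ∈ a ++ b
∈-remove a b p x≢y with ∈-insert⁻ a b p
... | inj₁ e = ⊥-elim (x≢y e)
... | inj₂ q = q

All-insert : ∀ {P : ℕ → Set} a b {x} → All P (a ++ b) → P x → All P (a ++ x ∷ b)
All-insert a b all px = Allₚ.++⁺ (Allₚ.++⁻ˡ a all) (px ∷ Allₚ.++⁻ʳ a all)

Unique-insert : ∀ a b {x : ℕ} → Unique (a ++ b) → x ∉ a ++ b → Unique (a ++ x ∷ b)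
Unique-insert [] b u x∉ = Allₚ.¬Any⇒All¬ b x∉ ∷ u
Unique-insert (h ∷ a) b (h∉ ∷ u) x∉ =
  All-insert a b h∉ (λ e → x∉ (here (sym e))) ∷ Unique-insert a b u (λ q → x∉ (there q))

Unique-middle⇒∉ : ∀ a b {x : ℕ} → Unique (a ++ x ∷ b) → x ∉ a
Unique-middle⇒∉ (y ∷ a) b (y∉ ∷ u) (here refl) = All.lookup y∉ (∈-insert a) refl
Unique-middle⇒∉ (y ∷ a) b (_ ∷ u) (there q) = Unique-middle⇒∉ a b u q

AllPairs-snoc : ∀ {R : ℕ → ℕ → Set} {l m} → AllPairs R l → (∀ x → x ∈ l → R x m) → AllPairs R (l ++ m ∷ [])
AllPairs-snoc ap h = AllPairsₚ.++⁺ ap ([] ∷ []) (All.tabulate (λ q → h _ q ∷ []))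

⊆-insert : ∀ a b {x : ℕ} → a ++ b ⊆ a ++ x ∷ b
⊆-insert a b = ++⁺ (⊆-refl {x = a}) (_ ∷ʳ ⊆-refl)

⊆-infix : ∀ (a c b : List ℕ) → a ++ b ⊆ a ++ c ++ b
⊆-infix a c b = ++⁺ (⊆-refl {x = a}) (++⁺ˡ c ⊆-refl)

⊆-middle : ∀ (p S s : List ℕ) → S ⊆ p ++ S ++ s
⊆-middle p S s = ++⁺ˡ p (++⁺ʳ s ⊆-refl)

length-snoc : ∀ (l : List ℕ) x → length (l ++ x ∷ []) ≡ suc (length l)
length-snoc l x = trans (length-++-sucʳ l x []) (cong (suc ∘ length) (++-identityʳ l))

++-regroup : ∀ (p S1 S2 s : List ℕ) → p ++ (S1 ++ S2) ++ s ≡ (p ++ S1) ++ (S2 ++ s)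
++-regroup p S1 S2 s = trans (cong (p ++_) (++-assoc S1 S2 s)) (sym (++-assoc p S1 (S2 ++ s)))

++-regroup-middle : ∀ (p π0 : List ℕ) xN ρ s → p ++ (π0 ++ xN ∷ ρ) ++ s ≡ (p ++ (π0 ++ xN ∷ [])) ++ (ρ ++ s)
++-regroup-middle p π0 xN ρ s = trans (cong (p ++_) (++-assoc π0 (xN ∷ ρ) s))
   (sym (trans (++-assoc p (π0 ++ xN ∷ []) (ρ ++ s)) (cong (p ++_) (++-assoc π0 (xN ∷ []) (ρ ++ s)))))

++-regroup-blockα : ∀ (p c S s : List ℕ) → p ++ (c ++ S) ++ s ≡ p ++ c ++ (S ++ s)
++-regroup-blockα p c S s = cong (p ++_) (++-assoc c S s)

++-regroup-blockβ : ∀ (p A c ρ s : List ℕ) → p ++ (A ++ c ++ ρ) ++ s ≡ (p ++ A) ++ c ++ (ρ ++ s)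
++-regroup-blockβ p A c ρ s = trans (cong (p ++_) (trans (++-assoc A (c ++ ρ) s) (cong (A ++_) (++-assoc c ρ s))))
  (sym (++-assoc p A (c ++ (ρ ++ s))))

∈-prefix-extend : ∀ (π0 : List ℕ) xN ρ {x} → x ∈ π0 ++ xN ∷ [] → x ∈ π0 ++ xN ∷ ρ
∈-prefix-extend π0 xN ρ q with ∈-++⁻ π0 q
... | inj₁ a = ∈-++⁺ˡ a
... | inj₂ (here e) = ∈-++⁺ʳ π0 (here e)

HeadSatisfies : (ℕ → Bool) → List ℕ → Set
HeadSatisfies p [] = ⊤
HeadSatisfies p (h ∷ _) = p h ≡ true

insertBeforeFirst-++ : ∀ p x π ρ → (∀ y → y ∈ π → p y ≡ false) → HeadSatisfies p ρ →
  insertBeforeFirst p x (π ++ ρ) ≡ π ++ x ∷ ρ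
insertBeforeFirst-++ p x [] [] h hp = refl
insertBeforeFirst-++ p x [] (r ∷ ρ) h hp rewrite hp = refl
insertBeforeFirst-++ p x (y ∷ π) ρ h hp rewrite h y (here refl) =
  cong (y ∷_) (insertBeforeFirst-++ p x π ρ (λ z q → h z (there q)) hp)

splitAfter-++ : ∀ x π ρ → x ∉ π → splitAfter x (π ++ x ∷ ρ) ≡ (π ++ x ∷ [] , ρ)
splitAfter-++ x [] ρ x∉ rewrite ≡ᵇ-refl x = refl
splitAfter-++ x (y ∷ π) ρ x∉
  rewrite ≢⇒≡ᵇ-false y x (λ e → x∉ (here (sym e))) | splitAfter-++ x π ρ (λ q → x∉ (there q)) = refl

-- Linear orders given as lists

before⇒∈ : ∀ l x y → before l x y ≡ true → x ∈ l × y ∈ l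
before⇒∈ [] x y ()
before⇒∈ (z ∷ zs) x y e with z ≡ᵇ x in e1 | z ≡ᵇ y
... | true | _ = here (sym (≡ᵇ-true⇒≡ z x e1)) , there (elem⇒∈ y zs e)
... | false | true = ⊥-elim (false≢true e)
... | false | false = let (xs , ys) = before⇒∈ zs x y e in there xs , there ys

before-++ : ∀ a b {x y} → Unique (a ++ b) → x ∈ a → y ∈ b → before (a ++ b) x y ≡ true
before-++ (z ∷ a) b {x} {y} u xa yb with z ≡ᵇ x in e1
... | true = ∈⇒elem (∈-++⁺ʳ a yb)
... | false with z ≡ᵇ y in e2
...   | true = ⊥-elim (Unique[x∷xs]⇒x∉xs u (subst (_∈ a ++ b) (sym (≡ᵇ-true⇒≡ z y e2)) (∈-++⁺ʳ a yb)))
...   | false = before-++ a b (AllPairs.tail u) (≡ᵇ-false⇒∈-tail e1 xa) yb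

before-asym : ∀ l {x y} → Unique l → before l x y ≡ true → before l y x ≡ false
before-asym [] u ()
before-asym (z ∷ zs) {x} {y} u e with z ≡ᵇ x in e1 | z ≡ᵇ y in e2
... | true | true = ⊥-elim (Unique[x∷xs]⇒x∉xs u (subst (_∈ zs) (sym (≡ᵇ-true⇒≡ z y e2)) (elem⇒∈ y zs e)))
... | true | false = refl
... | false | true = ⊥-elim (false≢true e)
... | false | false = before-asym zs (AllPairs.tail u) e

before-irrefl : ∀ l {x} → Unique l → before l x x ≡ false
before-irrefl [] u = refl
before-irrefl (z ∷ zs) {x} u with z ≡ᵇ x in e1
... | true = ∉⇒elem-false x zs (subst (_∉ zs) (≡ᵇ-true⇒≡ z x e1) (Unique[x∷xs]⇒x∉xs u))
... | false = before-irrefl zs (AllPairs.tail u)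

before-trans : ∀ l {x y w} → before l x y ≡ true → before l y w ≡ true → before l x w ≡ true
before-trans [] ()
before-trans (z ∷ zs) {x} {y} {w} e f with z ≡ᵇ x | z ≡ᵇ y | z ≡ᵇ w
... | true | true | _ = f
... | true | false | true = ⊥-elim (false≢true f)
... | true | false | false = ∈⇒elem (proj₂ (before⇒∈ zs y w f))
... | false | true | _ = ⊥-elim (false≢true e)
... | false | false | true = ⊥-elim (false≢true f)
... | false | false | false = before-trans zs e f

Unique-resp-⊇ : ∀ {xs ys : List ℕ} → xs ⊆ ys → Unique ys → Unique xs
Unique-resp-⊇ [] _ = []
Unique-resp-⊇ (_ ∷ʳ s) (_ ∷ u) = Unique-resp-⊇ s u
Unique-resp-⊇ (refl ∷ s) (a ∷ u) = All-resp-⊆ s a ∷ Unique-resp-⊇ s u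

before-⊆ : ∀ {l' l} → l' ⊆ l → Unique l → ∀ {x y} → x ∈ l' → y ∈ l' → before l' x y ≡ before l x y
before-⊆ [] u ()
before-⊆ (z ∷ʳ s) u {x} {y} xm ym
  rewrite ≢⇒≡ᵇ-false z x (λ e → Unique[x∷xs]⇒x∉xs u (subst (_∈ _) (sym e) (⊆-∈ s xm)))
        | ≢⇒≡ᵇ-false z y (λ e → Unique[x∷xs]⇒x∉xs u (subst (_∈ _) (sym e) (⊆-∈ s ym))) = before-⊆ s (AllPairs.tail u) xm ym
before-⊆ {z ∷ l1} {_ ∷ l2} (refl ∷ s) u {x} {y} xm ym with z ≡ᵇ x in e1
... | true = elem-agrees ym where
  elem-agrees : y ∈ z ∷ l1 → elem y l1 ≡ elem y l2
  elem-agrees (here refl) = trans (∉⇒elem-false y l1 (λ q → Unique[x∷xs]⇒x∉xs u (⊆-∈ s q))) (sym (∉⇒elem-false y l2 (Unique[x∷xs]⇒x∉xs u)))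
  elem-agrees (there q) = trans (∈⇒elem q) (sym (∈⇒elem (⊆-∈ s q)))
... | false with z ≡ᵇ y in e2
...   | true = refl
...   | false = before-⊆ s (AllPairs.tail u) (≡ᵇ-false⇒∈-tail e1 xm) (≡ᵇ-false⇒∈-tail e2 ym)

AllPairs⇒before : ∀ {R : ℕ → ℕ → Set} → (∀ {a} → ¬ R a a) → (∀ {a b} → R a b → ¬ R b a) →
  ∀ {l x y} → AllPairs R l → x ∈ l → y ∈ l → R x y → before l x y ≡ true
AllPairs⇒before irr asym {h ∷ t} {x} (_ ∷ _) (here refl) (here refl) rxy = ⊥-elim (irr rxy)
AllPairs⇒before irr asym {h ∷ t} {x} (_ ∷ _) (here refl) (there ym) rxy rewrite ≡ᵇ-refl x = ∈⇒elem ym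
AllPairs⇒before {R} irr asym {h ∷ t} {x} {y} (ah ∷ ap) (there xm) ym rxy
  rewrite ≢⇒≡ᵇ-false h x (λ e → irr (subst (R h) (sym e) (All.lookup ah xm))) with ym
... | here refl = ⊥-elim (asym rxy (All.lookup ah xm))
... | there ym' rewrite ≢⇒≡ᵇ-false h y (λ e → irr (subst (R h) (sym e) (All.lookup ah ym'))) =
  AllPairs⇒before irr asym ap xm ym' rxy

increasing⇒before : ∀ {l x y} → AllPairs _<_ l → x ∈ l → y ∈ l → x < y → before l x y ≡ true
increasing⇒before = AllPairs⇒before (<-irrefl refl) <-asym

decreasing⇒before : ∀ {l x y} → AllPairs _>_ l → x ∈ l → y ∈ l → y < x → before l x y ≡ true
decreasing⇒before = AllPairs⇒before (<-irrefl refl) <-asym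

increasing⇒Unique : ∀ {l} → AllPairs _<_ l → Unique l
increasing⇒Unique = AllPairs.map <⇒≢

decreasing⇒Unique : ∀ {l} → AllPairs _>_ l → Unique l
decreasing⇒Unique = AllPairs.map >⇒≢

before⇒< : ∀ {l x y} → AllPairs _<_ l → before l x y ≡ true → x < y
before⇒< {l} {x} {y} ap e with <-cmp x y | before⇒∈ l x y e
... | tri< x<y _ _ | _ = x<y
... | tri≈ _ refl _ | _ = ⊥-elim (false≢true (trans (sym (before-irrefl l (increasing⇒Unique ap))) e))
... | tri> _ _ y<x | xm , ym =
  ⊥-elim (false≢true (trans (sym (before-asym l (increasing⇒Unique ap) (increasing⇒before ap ym xm y<x))) e))

before-++-left : ∀ a b {x y} → Unique (a ++ b) → before (a ++ b) y x ≡ true → x ∈ a → y ∈ a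
before-++-left a b {x} {y} u e xa with ∈-++⁻ a (proj₁ (before⇒∈ (a ++ b) y x e))
... | inj₁ ya = ya
... | inj₂ yb = ⊥-elim (false≢true (trans (sym (before-asym (a ++ b) u (before-++ a b u xa yb))) e))

increasing⇒before-⊆ : ∀ {l F x y} → l ⊆ F → Unique F → AllPairs _<_ l → x ∈ l → y ∈ l → x < y → before F x y ≡ true
increasing⇒before-⊆ s u inc xl yl lt = trans (sym (before-⊆ s u xl yl)) (increasing⇒before inc xl yl lt)

before-middle-block : ∀ p S s {x y} → Unique (p ++ S ++ s) → before (p ++ S ++ s) y x ≡ true → x ∈ S → y ∈ p ⊎ y ∈ S
before-middle-block p S s {x} {y} u e xS = ∈-++⁻ p (before-++-left (p ++ S) s (subst Unique eq u) (subst (λ L → before L y x ≡ true) eq e) (∈-++⁺ʳ p xS))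
  where eq = sym (++-assoc p S s)

Spans : ℕ → List ℕ → Set
Spans n A = ∀ x → (x ∈ A → x < n) × (x < n → x ∈ A)

SpansRange : ℕ → ℕ → List ℕ → Set
SpansRange m0 m S = ∀ x → (x ∈ S → m0 ≤ x × x < m) × (m0 ≤ x × x < m → x ∈ S)

IsOrderOn : ℕ → List ℕ → Set
IsOrderOn n A = Unique A × Spans n A

IsOrderOn-insert : ∀ p S1 S2 s m → IsOrderOn m (p ++ (S1 ++ S2) ++ s) →
  IsOrderOn (suc m) (p ++ (S1 ++ m ∷ S2) ++ s) × (p ++ (S1 ++ S2) ++ s) ⊆ (p ++ (S1 ++ m ∷ S2) ++ s)
IsOrderOn-insert p S1 S2 s m (u , spans) rewrite ++-regroup p S1 S2 s | ++-regroup p S1 (m ∷ S2) s =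
  (Unique-insert (p ++ S1) (S2 ++ s) u (λ q → <-irrefl refl (proj₁ (spans m) q)) ,
   λ x → below x , contains x) , ⊆-insert (p ++ S1) (S2 ++ s) where
  below : ∀ x → x ∈ (p ++ S1) ++ m ∷ (S2 ++ s) → x < suc m
  below x q with ∈-insert⁻ (p ++ S1) (S2 ++ s) q
  ... | inj₁ refl = ≤-refl
  ... | inj₂ r = s≤s (<⇒≤ (proj₁ (spans x) r))
  contains : ∀ x → x < suc m → x ∈ (p ++ S1) ++ m ∷ (S2 ++ s)
  contains x (s≤s x≤m) with m≤n⇒m<n∨m≡n x≤m
  ... | inj₁ lt = ∈-insert⁺ (p ++ S1) (S2 ++ s) (proj₂ (spans x) lt)
  ... | inj₂ refl = ∈-insert (p ++ S1)

IsOrderOn-snoc : ∀ p S s m → IsOrderOn m (p ++ S ++ s) →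
  IsOrderOn (suc m) (p ++ (S ++ m ∷ []) ++ s) × (p ++ S ++ s) ⊆ (p ++ (S ++ m ∷ []) ++ s)
IsOrderOn-snoc p S s m ok
  with IsOrderOn-insert p S [] s m (subst (λ X → IsOrderOn m (p ++ X ++ s)) (sym (++-identityʳ S)) ok)
... | ok′ , sub = ok′ , subst (λ X → (p ++ X ++ s) ⊆ (p ++ (S ++ m ∷ []) ++ s)) (++-identityʳ S) sub

SpansRange-insert : ∀ {m0 m} S1 S2 → m0 ≤ m → SpansRange m0 m (S1 ++ S2) → SpansRange m0 (suc m) (S1 ++ m ∷ S2)
SpansRange-insert {m0} {m} S1 S2 le spans x = inRange , contains where
  inRange : x ∈ S1 ++ m ∷ S2 → m0 ≤ x × x < suc m
  inRange q with ∈-insert⁻ S1 S2 q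
  ... | inj₁ refl = le , ≤-refl
  ... | inj₂ r = proj₁ (proj₁ (spans x) r) , s≤s (<⇒≤ (proj₂ (proj₁ (spans x) r)))
  contains : m0 ≤ x × x < suc m → x ∈ S1 ++ m ∷ S2
  contains (a , s≤s b) with m≤n⇒m<n∨m≡n b
  ... | inj₁ lt = ∈-insert⁺ S1 S2 (proj₂ (spans x) (a , lt))
  ... | inj₂ refl = ∈-insert S1

SpansRange-snoc : ∀ {m0 m} S → m0 ≤ m → SpansRange m0 m S → SpansRange m0 (suc m) (S ++ m ∷ [])
SpansRange-snoc {m0} {m} S le spans = SpansRange-insert S [] le (subst (SpansRange m0 m) (sym (++-identityʳ S)) spans)

-- Counting colours

injection-length-≤ : ∀ (g : ℕ → ℕ) l v → Unique l → (∀ a b → a ∈ l → b ∈ l → g a ≡ g b → a ≡ b) →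
  (∀ a → a ∈ l → g a ∈ v) → length l ≤ length v
injection-length-≤ g [] v u inj h = z≤n
injection-length-≤ g (a ∷ l) v u inj h with ∈-∃++ (h a (here refl))
... | v1 , v2 , refl = subst (suc (length l) ≤_) (sym (length-++-sucʳ v1 (g a) v2))
  (s≤s (injection-length-≤ g l (v1 ++ v2) (AllPairs.tail u) (λ x y xm ym → inj x y (there xm) (there ym))
    λ b bm → ∈-remove v1 v2 (h b (there bm))
      (λ e → Unique[x∷xs]⇒x∉xs u (subst (_∈ l) (inj b a (there bm) (here refl) e) bm))))

countDistinct-map≡length : ∀ (c : ℕ → ℕ) l π → Unique π → (∀ a b → a ∈ π → b ∈ π → c a ≡ c b → a ≡ b) →
  (∀ a → a ∈ π → a ∈ l) → (∀ s → s ∈ l → ∃ λ z → z ∈ π × c z ≡ c s) → countDistinct (map c l) ≡ length π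
countDistinct-map≡length c l π uπ inj πl cov = ≤-antisym atMost atLeast where
  D = deduplicate _≟_ (map c l)
  atMost : length D ≤ length π
  atMost = subst (length D ≤_) (length-map c π)
    (injection-length-≤ id D (map c π) (deduplicate-! _≟_ (map c l)) (λ a b _ _ e → e) λ a am →
      let (s , sm , e) = ∈-map⁻ c (∈-deduplicate⁻ _≟_ (map c l) am)
          (z , zm , e2) = cov s sm
      in subst (_∈ map c π) (trans e2 (sym e)) (∈-map⁺ c zm))
  atLeast : length π ≤ length D
  atLeast = injection-length-≤ c π D uπ inj λ a am → ∈-deduplicate⁺ _≟_ (∈-map⁺ c (πl a am))

findColour : (c : ℕ → ℕ) (v : ℕ) (l : List ℕ) → (∃ λ z → z ∈ l × c z ≡ v) ⊎ (∀ z → z ∈ l → c z ≢ v)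
findColour c v [] = inj₂ (λ z ())
findColour c v (y ∷ l) with c y ≟ v
... | yes e = inj₁ (y , here refl , e)
... | no ne with findColour c v l
...   | inj₁ (z , zm , e) = inj₁ (z , there zm , e)
...   | inj₂ h = inj₂ λ { z (here refl) → ne ; z (there p) → h z p }

-- The poset L_α ∩ L_β and its colouring

ltB-intro : ∀ {α β x y} → before α x y ≡ true → before β x y ≡ true → ltB α β x y ≡ true
ltB-intro p q rewrite p | q = refl

ltB-α : ∀ {α β x y} → ltB α β x y ≡ true → before α x y ≡ true
ltB-α {α} {β} {x} {y} e with before α x y
... | true = refl
... | false = e

ltB-β : ∀ {α β x y} → ltB α β x y ≡ true → before β x y ≡ true
ltB-β {α} {β} {x} {y} e with before α x y
... | true = e
... | false = ⊥-elim (false≢true e)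

ltB-falseα : ∀ {α β x y} → before α x y ≡ false → ltB α β x y ≡ false
ltB-falseα p rewrite p = refl

ltB-falseβ : ∀ {α β x y} → before β x y ≡ false → ltB α β x y ≡ false
ltB-falseβ {α} {β} {x} {y} p rewrite p with before α x y
... | true = refl
... | false = refl

rel-posetMatrix : ∀ α β n (a b : Fin n) → rel (posetMatrix α β n) a b ≡ ltB α β (toℕ a) (toℕ b)
rel-posetMatrix α β n a b = trans (cong (λ v → Data.Vec.lookup v b) (lookup∘tabulate _ a)) (lookup∘tabulate _ b)

colorAt-cong : ∀ B Gα Gβ Fα Fβ x → (∀ a b → a ≤ x → b ≤ x → ltB Gα Gβ a b ≡ ltB Fα Fβ a b) →
               colorAt B Gα Gβ x ≡ colorAt B Fα Fβ x
colorAt-cong B Gα Gβ Fα Fβ x h = cong (B x) (tabulate-cong λ a → tabulate-cong λ b →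
  h (toℕ a) (toℕ b) (≤-pred (toℕ<n a)) (≤-pred (toℕ<n b)))

ltB-⊆ : ∀ {Gα Gβ Fα Fβ} → Gα ⊆ Fα → Gβ ⊆ Fβ → Unique Fα → Unique Fβ → ∀ {a b} →
          a ∈ Gα → a ∈ Gβ → b ∈ Gα → b ∈ Gβ → ltB Gα Gβ a b ≡ ltB Fα Fβ a b
ltB-⊆ sα sβ uα uβ aα aβ bα bβ = cong₂ _∧_ (before-⊆ sα uα aα bα) (before-⊆ sβ uβ aβ bβ)

colorAt-⊆ : ∀ B Gα Gβ Fα Fβ x → Gα ⊆ Fα → Gβ ⊆ Fβ → Unique Fα → Unique Fβ →
              (∀ a → a ≤ x → a ∈ Gα × a ∈ Gβ) → colorAt B Gα Gβ x ≡ colorAt B Fα Fβ x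
colorAt-⊆ B Gα Gβ Fα Fβ x sα sβ uα uβ h = colorAt-cong B Gα Gβ Fα Fβ x λ a b a≤ b≤ →
  ltB-⊆ sα sβ uα uβ (proj₁ (h a a≤)) (proj₂ (h a a≤)) (proj₁ (h b b≤)) (proj₂ (h b b≤))

ltB-irrefl : ∀ {α β x} → Unique α → ltB α β x x ≡ false
ltB-irrefl {α} {β} {x} u = ltB-falseα {α} {β} (before-irrefl α u)

ltB-trans : ∀ {α β x y z} → ltB α β x y ≡ true → ltB α β y z ≡ true → ltB α β x z ≡ true
ltB-trans {α} {β} p q = ltB-intro {α} {β} (before-trans α (ltB-α {α} {β} p) (ltB-α {α} {β} q))
  (before-trans β (ltB-β {α} {β} p) (ltB-β {α} {β} q))

posetMatrix-isStrictPO : ∀ α β n → Unique α → IsStrictPO (posetMatrix α β n)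
posetMatrix-isStrictPO α β n u = (λ a → trans (rel-posetMatrix α β n a a) (ltB-irrefl {α} {β} u)) ,
  λ a b c p q → trans (rel-posetMatrix α β n a c) (ltB-trans {α} {β}
     (trans (sym (rel-posetMatrix α β n a b)) p) (trans (sym (rel-posetMatrix α β n b c)) q))

restrictM-posetMatrix : ∀ α β n (i : Fin n) → restrictM (posetMatrix α β n) i ≡ posetMatrix α β (suc (toℕ i))
restrictM-posetMatrix α β n i = tabulate-cong λ a → tabulate-cong λ b →
  trans (rel-posetMatrix α β n _ _) (cong₂ (ltB α β) (toℕ-inject≤ a (toℕ<n i)) (toℕ-inject≤ b (toℕ<n i)))

colorM-posetMatrix : ∀ B α β n (i : Fin n) → colorM B (posetMatrix α β n) i ≡ colorAt B α β (toℕ i)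
colorM-posetMatrix B α β n i = cong (B (toℕ i)) (restrictM-posetMatrix α β n i)

rel-posetMatrix-fromℕ< : ∀ α β n {x y} (x<n : x < n) (y<n : y < n) →
  rel (posetMatrix α β n) (fromℕ< x<n) (fromℕ< y<n) ≡ ltB α β x y
rel-posetMatrix-fromℕ< α β n x<n y<n =
  trans (rel-posetMatrix α β n _ _) (cong₂ (ltB α β) (toℕ-fromℕ< x<n) (toℕ-fromℕ< y<n))

colorM-posetMatrix-fromℕ< : ∀ B α β n {x} (x<n : x < n) →
  colorM B (posetMatrix α β n) (fromℕ< x<n) ≡ colorAt B α β x
colorM-posetMatrix-fromℕ< B α β n x<n =
  trans (colorM-posetMatrix B α β n _) (cong (colorAt B α β) (toℕ-fromℕ< x<n))

sameColour⇒comparable : ∀ B → IsChainPartitioner B → ∀ {α β n x y} → Unique α → x < n → y < n → x ≢ y →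
  colorAt B α β x ≡ colorAt B α β y → ltB α β x y ≡ true ⊎ ltB α β y x ≡ true
sameColour⇒comparable B cp {α} {β} {n} {x} {y} u x<n y<n x≢y same =
  Sum.map (trans (sym (rel-posetMatrix-fromℕ< α β n x<n y<n))) (trans (sym (rel-posetMatrix-fromℕ< α β n y<n x<n)))
    (cp n (posetMatrix α β n) (posetMatrix-isStrictPO α β n u) (fromℕ< x<n) (fromℕ< y<n) distinct sameM)
  where
  distinct : fromℕ< x<n ≢ fromℕ< y<n
  distinct e = x≢y (trans (sym (toℕ-fromℕ< x<n)) (trans (cong toℕ e) (toℕ-fromℕ< y<n)))
  sameM : colorM B (posetMatrix α β n) (fromℕ< x<n) ≡ colorM B (posetMatrix α β n) (fromℕ< y<n)
  sameM = trans (colorM-posetMatrix-fromℕ< B α β n x<n) (trans same (sym (colorM-posetMatrix-fromℕ< B α β n y<n)))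

Incomparable-sym : ∀ {α β x y} → Incomparable α β x y → Incomparable α β y x
Incomparable-sym {α} {β} (x≢y , x≮y , y≮x) = (λ e → x≢y (sym e)) , y≮x , x≮y

incomparable⇒differentColours : ∀ B → IsChainPartitioner B → ∀ {α β n x y} → Unique α → x < n → y < n →
  Incomparable α β x y → colorAt B α β x ≢ colorAt B α β y
incomparable⇒differentColours B cp {α} {β} u x<n y<n (x≢y , x≮y , y≮x) same
  with sameColour⇒comparable B cp {α} {β} u x<n y<n x≢y same
... | inj₁ x<y = false≢true (trans (sym x≮y) x<y)
... | inj₂ y<x = false≢true (trans (sym y≮x) y<x)

-- Stage 1

module Traversal (lt : ℕ → ℕ → Bool) (col : ℕ → ℕ) (GI GJ SI π ρ L : List ℕ)
   (uI : Unique GI) (uJ : Unique GJ) (sI : SI ⊆ GI) (sJ : (π ++ ρ) ⊆ GJ)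
   (incI : AllPairs _<_ SI)
   (LtoS : ∀ z → z ∈ L → z ∈ π ++ ρ)
   (StoL : ∀ z → z ∈ π ++ ρ → z ∈ L)
   (JtoI : ∀ z → z ∈ π ++ ρ → z ∈ SI)
   (ltI : ∀ {z y} → lt z y ≡ true → before GI z y ≡ true)
   (ltJ : ∀ {z y} → lt z y ≡ true → before GJ z y ≡ true)
   (ltmk : ∀ {z y} → before GI z y ≡ true → before GJ z y ≡ true → lt z y ≡ true)
   (dist : ∀ a b → a ∈ π → b ∈ π → col a ≡ col b → a ≡ b)
   (cov : ∀ y → y ∈ ρ → ∃ λ z → z ∈ π × z < y × col z ≡ col y)
 where

  stopsAt : ℕ → Bool
  stopsAt y = any (λ z → lt z y ∧ (col z ≡ᵇ col y)) L

  uJS : Unique (π ++ ρ)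
  uJS = Unique-resp-⊇ sJ uJ

  ¬stopsAt-π : ∀ y → y ∈ π → stopsAt y ≡ false
  ¬stopsAt-π y yπ = any-false _ L q where
    yS : y ∈ π ++ ρ
    yS = ∈-++⁺ˡ yπ
    q : ∀ z → z ∈ L → (lt z y ∧ (col z ≡ᵇ col y)) ≡ false
    q z zL with lt z y in e
    ... | false = refl
    ... | true with ∈-++⁻ π (LtoS z zL)
    ...   | inj₂ zρ = ⊥-elim (false≢true (trans (sym (before-asym (π ++ ρ) uJS (before-++ π ρ uJS yπ zρ)))
                (trans (before-⊆ sJ uJ (LtoS z zL) yS) (ltJ e))))
    ...   | inj₁ zπ = ≢⇒≡ᵇ-false (col z) (col y) λ ce → <-irrefl (dist z y zπ yπ ce) zy where
      zy : z < y
      zy = before⇒< incI (trans (before-⊆ sI uI (JtoI z (LtoS z zL)) (JtoI y yS)) (ltI e))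

  stopsAt-head-ρ : HeadSatisfies stopsAt ρ
  stopsAt-head-ρ = go ρ (λ y q → q) where
    go : ∀ r → (∀ y → y ∈ r → y ∈ ρ) → HeadSatisfies stopsAt r
    go [] _ = _
    go (h ∷ r) sub with cov h (sub h (here refl))
    ... | z , zπ , z<h , ce = any-true _ (StoL z (∈-++⁺ˡ zπ)) q where
      hρ : h ∈ ρ
      hρ = sub h (here refl)
      q : (lt z h ∧ (col z ≡ᵇ col h)) ≡ true
      q rewrite ltmk {z} {h}
          (trans (sym (before-⊆ sI uI (JtoI z (∈-++⁺ˡ zπ)) (JtoI h (∈-++⁺ʳ π hρ))))
                 (increasing⇒before incI (JtoI z (∈-++⁺ˡ zπ)) (JtoI h (∈-++⁺ʳ π hρ)) z<h))
          (trans (sym (before-⊆ sJ uJ (∈-++⁺ˡ zπ) (∈-++⁺ʳ π hρ))) (before-++ π ρ uJS zπ hρ))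
          | ce = ≡ᵇ-refl (col h)

antichain-colour-injective : ∀ (lt : ℕ → ℕ → Bool) (col : ℕ → ℕ) GI GJ SI R → Unique GI → Unique GJ → SI ⊆ GI → R ⊆ GJ →
  AllPairs _<_ SI → AllPairs _>_ R → (∀ z → z ∈ R → z ∈ SI) →
  (∀ {z y} → lt z y ≡ true → before GI z y ≡ true) →
  (∀ {z y} → lt z y ≡ true → before GJ z y ≡ true) →
  (∀ a b → a ∈ R → b ∈ R → a ≢ b → col a ≡ col b → lt a b ≡ true ⊎ lt b a ≡ true) →
  ∀ a b → a ∈ R → b ∈ R → col a ≡ col b → a ≡ b
antichain-colour-injective lt col GI GJ SI R uI uJ sI sJ incI decR RI ltI ltJ cp = main where
  oneway : ∀ a b → a ∈ R → b ∈ R → a < b → col a ≡ col b → ⊥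
  oneway a b aR bR a<b ce with cp a b aR bR (<⇒≢ a<b) ce
  ... | inj₁ e = false≢true (trans (sym (before-asym GJ uJ
          (trans (sym (before-⊆ sJ uJ bR aR)) (decreasing⇒before decR bR aR a<b)))) (ltJ e))
  ... | inj₂ e = false≢true (trans (sym (before-asym GI uI
          (trans (sym (before-⊆ sI uI (RI a aR) (RI b bR))) (increasing⇒before incI (RI a aR) (RI b bR) a<b)))) (ltI e))
  main : ∀ a b → a ∈ R → b ∈ R → col a ≡ col b → a ≡ b
  main a b aR bR ce with <-cmp a b
  ... | tri< x _ _ = ⊥-elim (oneway a b aR bR x ce)
  ... | tri≈ _ e _ = e
  ... | tri> _ _ x = ⊥-elim (oneway b a bR aR x (sym ce))

embedα : Ctx → List ℕ → List ℕ
embedα C S = preα C ++ S ++ sufα C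

embedβ : Ctx → List ℕ → List ℕ
embedβ C S = preβ C ++ S ++ sufβ C

blocked : OnlineAlg → Ctx → List ℕ → List ℕ → ℕ → Bool
blocked B C Sα Sβ y = any (λ z → ltB (embedα C Sα) (embedβ C Sβ) z y ∧ (colorAt B (embedα C Sα) (embedβ C Sβ) z ≡ᵇ colorAt B (embedα C Sα) (embedβ C Sβ) y)) Sα

stage1-round-k<w : OnlineAlg → ℕ → ℕ → ℕ → Ctx → List ℕ → ℕ → List ℕ → Maybe (List ℕ × List ℕ × ℕ × ℕ)
stage1-round-k<w B f k W C Sα m X =
  if W ≤ᵇ countDistinct (map (colorAt B (embedα C (Sα ++ m ∷ [])) (embedβ C X)) (Sα ++ m ∷ []))
  then just (Sα ++ m ∷ [] , X , suc m , m)
  else stage1 B f k W C (Sα ++ m ∷ []) X (suc m)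

stage1-unfold-k<w : ∀ B f k W C Sα Sβ m → (k <ᵇ W) ≡ true →
  stage1 B (suc f) k W C Sα Sβ m ≡ stage1-round-k<w B f k W C Sα m (insertBeforeFirst (blocked B C Sα Sβ) m Sβ)
stage1-unfold-k<w B f k W C Sα Sβ m e rewrite e = refl

stage1-round-k≡w : OnlineAlg → ℕ → ℕ → ℕ → Ctx → List ℕ → ℕ → List ℕ → Maybe (List ℕ × List ℕ × ℕ × ℕ)
stage1-round-k≡w B f k W C Sβ m X =
  if W ≤ᵇ countDistinct (map (colorAt B (embedα C X) (embedβ C (Sβ ++ m ∷ []))) X)
  then just (X , Sβ ++ m ∷ [] , suc m , m)
  else stage1 B f k W C X (Sβ ++ m ∷ []) (suc m)

stage1-unfold-k≡w : ∀ B f k W C Sα Sβ m → (k <ᵇ W) ≡ false →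
  stage1 B (suc f) k W C Sα Sβ m ≡ stage1-round-k≡w B f k W C Sβ m (insertBeforeFirst (blocked B C Sα Sβ) m Sα)
stage1-unfold-k≡w B f k W C Sα Sβ m e rewrite e = refl

-- I is the order in which the Stage-1 points SI are stacked in introduction order, J the
-- one in which they are inserted by the traversal, as SJ = π ++ ρ.
record Stage1Inv (col : ℕ → ℕ) (W m0 m : ℕ) (GI GJ SI SJ π ρ : List ℕ) : Set where
  field
    eqJ : SJ ≡ π ++ ρ
    m0≤m : m0 ≤ m
    okI : IsOrderOn m GI
    okJ : IsOrderOn m GJ
    memI : SpansRange m0 m SI
    memJ : SpansRange m0 m SJ
    subI : SI ⊆ GI
    subJ : SJ ⊆ GJ
    incI : AllPairs _<_ SI
    incπ : AllPairs _<_ π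
    decρ : AllPairs _>_ ρ
    dist : ∀ a b → a ∈ π → b ∈ π → col a ≡ col b → a ≡ b
    cov : ∀ y → y ∈ ρ → ∃ λ z → z ∈ π × z < y × col z ≡ col y
    lenπ : suc (length π) ≤ W
    lenρ : length ρ ≤ length π

record Stage1Out (col : ℕ → ℕ) (W m0 : ℕ) (GI GJ SI π0 : List ℕ) (xN : ℕ) (ρ : List ℕ) : Set where
  field
    m0≤xN : m0 ≤ xN
    okI : IsOrderOn (suc xN) GI
    okJ : IsOrderOn (suc xN) GJ
    memI : SpansRange m0 (suc xN) SI
    memJ : SpansRange m0 (suc xN) (π0 ++ xN ∷ ρ)
    incI : AllPairs _<_ SI
    incπ : AllPairs _<_ (π0 ++ xN ∷ [])
    dist : ∀ a b → a ∈ π0 ++ xN ∷ [] → b ∈ π0 ++ xN ∷ [] → col a ≡ col b → a ≡ b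
    len : length (π0 ++ xN ∷ []) ≡ W

module Stage1Facts (col : ℕ → ℕ) (W m0 m : ℕ) (GI GJ SI π ρ : List ℕ)
   (inv : Stage1Inv col W m0 m GI GJ SI (π ++ ρ) π ρ) where
  open Stage1Inv inv

  JtoI : ∀ z → z ∈ π ++ ρ → z ∈ SI
  JtoI z q = proj₂ (memI z) (proj₁ (memJ z) q)
  ItoJ : ∀ z → z ∈ SI → z ∈ π ++ ρ
  ItoJ z q = proj₂ (memJ z) (proj₁ (memI z) q)

  traversal-inserts-between : ∀ (lt : ℕ → ℕ → Bool) L →
   (∀ z → z ∈ L → z ∈ π ++ ρ) → (∀ z → z ∈ π ++ ρ → z ∈ L) →
   (∀ {z y} → lt z y ≡ true → before GI z y ≡ true) →
   (∀ {z y} → lt z y ≡ true → before GJ z y ≡ true) →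
   (∀ {z y} → before GI z y ≡ true → before GJ z y ≡ true → lt z y ≡ true) →
   insertBeforeFirst (λ y → any (λ z → lt z y ∧ (col z ≡ᵇ col y)) L) m (π ++ ρ) ≡ π ++ m ∷ ρ
  traversal-inserts-between lt L LtoS StoL ltI ltJ ltmk = insertBeforeFirst-++ _ m π ρ S.¬stopsAt-π S.stopsAt-head-ρ where
    module S = Traversal lt col GI GJ SI π ρ L (proj₁ okI) (proj₁ okJ) subI subJ incI LtoS StoL JtoI ltI ltJ ltmk dist cov

module Stage1Round (col col' : ℕ → ℕ) (W m0 m : ℕ) (pI sI pJ sJ SI π ρ : List ℕ)
   (inv : Stage1Inv col W m0 m (pI ++ SI ++ sI) (pJ ++ (π ++ ρ) ++ sJ) SI (π ++ ρ) π ρ)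
   (lt' : ℕ → ℕ → Bool)
   (ltI' : ∀ {z y} → lt' z y ≡ true → before (pI ++ (SI ++ m ∷ []) ++ sI) z y ≡ true)
   (ltJ' : ∀ {z y} → lt' z y ≡ true → before (pJ ++ (π ++ m ∷ ρ) ++ sJ) z y ≡ true)
   (comparable′ : ∀ a b → a < suc m → b < suc m → a ≢ b → col' a ≡ col' b → lt' a b ≡ true ⊎ lt' b a ≡ true)
   (colours-stable : ∀ x → x < m → col x ≡ col' x)
   (L' : List ℕ) (L'⁺ : ∀ x → x ∈ L' → x ∈ SI ++ m ∷ []) (L'⁻ : ∀ x → x ∈ SI ++ m ∷ [] → x ∈ L')
  where
  open Stage1Inv inv
  open Stage1Facts col W m0 m (pI ++ SI ++ sI) (pJ ++ (π ++ ρ) ++ sJ) SI π ρ inv using (JtoI; ItoJ)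

  GI' = pI ++ (SI ++ m ∷ []) ++ sI
  GJ' = pJ ++ (π ++ m ∷ ρ) ++ sJ

  okI' : IsOrderOn (suc m) GI'
  okI' = proj₁ (IsOrderOn-snoc pI SI sI m okI)
  okJ' : IsOrderOn (suc m) GJ'
  okJ' = proj₁ (IsOrderOn-insert pJ π ρ sJ m okJ)
  memI' : SpansRange m0 (suc m) (SI ++ m ∷ [])
  memI' = SpansRange-snoc SI m0≤m memI
  memJ' : SpansRange m0 (suc m) (π ++ m ∷ ρ)
  memJ' = SpansRange-insert π ρ m0≤m memJ
  incI' : AllPairs _<_ (SI ++ m ∷ [])
  incI' = AllPairs-snoc incI (λ x q → proj₂ (proj₁ (memI x) q))
  subI' : (SI ++ m ∷ []) ⊆ GI'
  subI' = ⊆-middle pI (SI ++ m ∷ []) sI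
  subJ' : (π ++ m ∷ ρ) ⊆ GJ'
  subJ' = ⊆-middle pJ (π ++ m ∷ ρ) sJ

  ltm : ∀ x → x ∈ π ++ ρ → x < m
  ltm x q = proj₂ (proj₁ (memJ x) q)
  ltmπ : ∀ x → x ∈ π → x < m
  ltmπ x q = ltm x (∈-++⁺ˡ q)
  ltmρ : ∀ x → x ∈ ρ → x < m
  ltmρ x q = ltm x (∈-++⁺ʳ π q)

  dist' : ∀ a b → a ∈ π → b ∈ π → col' a ≡ col' b → a ≡ b
  dist' a b aq bq e = dist a b aq bq (trans (colours-stable a (ltmπ a aq)) (trans e (sym (colours-stable b (ltmπ b bq)))))

  covρ' : ∀ y → y ∈ ρ → ∃ λ z → z ∈ π × z < y × col' z ≡ col' y
  covρ' y q with cov y q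
  ... | z , zπ , zy , e = z , zπ , zy , trans (sym (colours-stable z (ltmπ z zπ))) (trans e (colours-stable y (ltmρ y q)))

  πinL : ∀ a → a ∈ π → a ∈ L'
  πinL a q = L'⁻ a (∈-++⁺ˡ (JtoI a (∈-++⁺ˡ q)))

  mL : m ∈ L'
  mL = L'⁻ m (∈-++⁺ʳ SI (here refl))

  Outcome : Set
  Outcome = (W ≤ countDistinct (map col' L') × Stage1Out col' W m0 GI' GJ' (SI ++ m ∷ []) π m ρ)
    ⊎ (∃₂ λ π' ρ' → countDistinct (map col' L') < W × Stage1Inv col' W m0 (suc m) GI' GJ' (SI ++ m ∷ []) (π ++ m ∷ ρ) π' ρ'
        × length π' + length ρ' ≡ suc (length π + length ρ))

  repeatedColour : ∀ z → z ∈ π → col' z ≡ col' m → Outcome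
  repeatedColour z zπ ce = inj₂ (π , m ∷ ρ , cnt , inv' , +-suc (length π) (length ρ)) where
    decρ' : AllPairs _>_ (m ∷ ρ)
    decρ' = All.tabulate (ltmρ _) ∷ decρ
    cov' : ∀ y → y ∈ m ∷ ρ → ∃ λ z → z ∈ π × z < y × col' z ≡ col' y
    cov' y (here refl) = z , zπ , ltmπ z zπ , ce
    cov' y (there q) = covρ' y q
    ltS : ∀ a → a ∈ m ∷ ρ → a < suc m
    ltS a q = proj₂ (proj₁ (memJ' a) (∈-++⁺ʳ π q))
    inj : ∀ a b → a ∈ m ∷ ρ → b ∈ m ∷ ρ → col' a ≡ col' b → a ≡ b
    inj = antichain-colour-injective lt' col' GI' GJ' (SI ++ m ∷ []) (m ∷ ρ) (proj₁ okI') (proj₁ okJ') subI'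
      (⊆-trans (++⁺ˡ π ⊆-refl) subJ') incI' decρ'
      (λ x q → proj₂ (memI' x) (proj₁ (memJ' x) (∈-++⁺ʳ π q))) ltI' ltJ'
      (λ a b aq bq ne e → comparable′ a b (ltS a aq) (ltS b bq) ne e)
    vals : ∀ a → a ∈ m ∷ ρ → col' a ∈ map col' π
    vals a q with cov' a q
    ... | z , zπ , _ , e = subst (_∈ map col' π) e (∈-map⁺ col' zπ)
    lenρ' : length (m ∷ ρ) ≤ length π
    lenρ' = subst (length (m ∷ ρ) ≤_) (length-map col' π) (injection-length-≤ col' (m ∷ ρ) (map col' π) (decreasing⇒Unique decρ') inj vals)
    inv' : Stage1Inv col' W m0 (suc m) GI' GJ' (SI ++ m ∷ []) (π ++ m ∷ ρ) π (m ∷ ρ)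
    inv' = record
      { eqJ = refl ; m0≤m = ≤-trans m0≤m (n≤1+n m) ; okI = okI' ; okJ = okJ' ; memI = memI' ; memJ = memJ'
      ; subI = subI' ; subJ = subJ' ; incI = incI' ; incπ = incπ ; decρ = decρ' ; dist = dist' ; cov = cov'
      ; lenπ = lenπ ; lenρ = lenρ' }
    covL : ∀ s → s ∈ L' → ∃ λ z → z ∈ π × col' z ≡ col' s
    covL s q with ∈-++⁻ SI (L'⁺ s q)
    ... | inj₂ (here refl) = z , zπ , ce
    ... | inj₁ sI with ∈-++⁻ π (ItoJ s sI)
    ...   | inj₁ sπ = s , sπ , refl
    ...   | inj₂ sρ with covρ' s sρ
    ...     | z' , zπ' , _ , e = z' , zπ' , e
    cnt : countDistinct (map col' L') < W
    cnt = subst (_< W) (sym (countDistinct-map≡length col' L' π (increasing⇒Unique incπ) dist' πinL covL)) lenπ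

  module NewColour (nc : ∀ z → z ∈ π → col' z ≢ col' m) where
    π' = π ++ m ∷ []
    incπ' : AllPairs _<_ π'
    incπ' = AllPairs-snoc incπ ltmπ
    dist'' : ∀ a b → a ∈ π' → b ∈ π' → col' a ≡ col' b → a ≡ b
    dist'' a b aq bq e with ∈-++⁻ π aq | ∈-++⁻ π bq
    ... | inj₁ a1 | inj₁ b1 = dist' a b a1 b1 e
    ... | inj₁ a1 | inj₂ (here refl) = ⊥-elim (nc a a1 e)
    ... | inj₂ (here refl) | inj₁ b1 = ⊥-elim (nc b b1 (sym e))
    ... | inj₂ (here refl) | inj₂ (here refl) = refl
    πL : ∀ a → a ∈ π' → a ∈ L'
    πL a q with ∈-++⁻ π q
    ... | inj₁ a1 = πinL a a1
    ... | inj₂ (here refl) = mL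
    covL : ∀ s → s ∈ L' → ∃ λ z → z ∈ π' × col' z ≡ col' s
    covL s q with ∈-++⁻ SI (L'⁺ s q)
    ... | inj₂ (here refl) = m , ∈-++⁺ʳ π (here refl) , refl
    ... | inj₁ sI with ∈-++⁻ π (ItoJ s sI)
    ...   | inj₁ sπ = s , ∈-++⁺ˡ sπ , refl
    ...   | inj₂ sρ with covρ' s sρ
    ...     | z' , zπ' , _ , e = z' , ∈-++⁺ˡ zπ' , e
    cnteq : countDistinct (map col' L') ≡ length π'
    cnteq = countDistinct-map≡length col' L' π' (increasing⇒Unique incπ') dist'' πL covL

    res : Outcome
    res with m≤n⇒m<n∨m≡n lenπ
    ... | inj₂ eq = inj₁ (subst (W ≤_) (sym cnteq) (≤-reflexive (sym eq')) , out) where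
      eq' : length π' ≡ W
      eq' = trans (length-snoc π m) eq
      out : Stage1Out col' W m0 GI' GJ' (SI ++ m ∷ []) π m ρ
      out = record { m0≤xN = m0≤m ; okI = okI' ; okJ = okJ' ; memI = memI' ; memJ = memJ' ; incI = incI'
                   ; incπ = incπ' ; dist = dist'' ; len = eq' }
    ... | inj₁ lt = inj₂ (π' , ρ , subst (_< W) (sym cnteq) (subst (_< W) (sym (length-snoc π m)) lt) , inv' ,
                          cong (_+ length ρ) (length-snoc π m)) where
      inv' : Stage1Inv col' W m0 (suc m) GI' GJ' (SI ++ m ∷ []) (π ++ m ∷ ρ) π' ρ
      inv' = record
        { eqJ = sym (++-assoc π (m ∷ []) ρ) ; m0≤m = ≤-trans m0≤m (n≤1+n m) ; okI = okI' ; okJ = okJ' ; memI = memI' ; memJ = memJ'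
        ; subI = subI' ; subJ = subJ' ; incI = incI' ; incπ = incπ' ; decρ = decρ ; dist = dist''
        ; cov = λ y q → let (z , zπ , zy , e) = covρ' y q in z , ∈-++⁺ˡ zπ , zy , e
        ; lenπ = subst (λ t → suc t ≤ W) (sym (length-snoc π m)) lt
        ; lenρ = ≤-trans lenρ (subst (length π ≤_) (sym (length-snoc π m)) (n≤1+n _)) }

  newColour : (∀ z → z ∈ π → col' z ≢ col' m) → Outcome
  newColour nc = NewColour.res nc

  outcome : Outcome
  outcome with findColour col' (col' m) π
  ... | inj₁ (z , zπ , ce) = repeatedColour z zπ ce
  ... | inj₂ nc = newColour nc

fuel-cannot-run-out : ∀ W p r → suc p ≤ W → r ≤ p → W + W ≤ suc (p + r) → ⊥
fuel-cannot-run-out W p r a b c = <-irrefl refl (≤-trans (subst (_≤ W + W) (+-suc (suc p) p) (+-mono-≤ a a))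
                                   (≤-trans c (s≤s (+-mono-≤ (≤-refl {p}) b))))

fuel-step : ∀ W f x y → W + W ≤ suc (suc f + x) → y ≡ suc x → W + W ≤ suc (f + y)
fuel-step W f x y le refl = subst (λ t → W + W ≤ suc t) (sym (+-suc f x)) le

Stage1OutL : OnlineAlg → ℕ → ℕ → Ctx → List ℕ → List ℕ → ℕ → List ℕ → Set
Stage1OutL B W m0 C Sα π0 xN ρ = Stage1Out (colorAt B (embedα C Sα) (embedβ C (π0 ++ xN ∷ ρ))) W m0 (embedα C Sα) (embedβ C (π0 ++ xN ∷ ρ)) Sα π0 xN ρ

-- f + |π| + |ρ| is the same in every round, and the fuel cannot run out before Stage 1
-- ends because |π| + |ρ| ≤ 2|π| < 2W.
stage1-k<w : ∀ B → IsChainPartitioner B → ∀ k W C m0 → (k <ᵇ W) ≡ true → ∀ f m Sα Sβ π ρ →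
  Stage1Inv (colorAt B (embedα C Sα) (embedβ C Sβ)) W m0 m (embedα C Sα) (embedβ C Sβ) Sα Sβ π ρ →
  W + W ≤ suc (f + (length π + length ρ)) →
  ∃ λ Sα* → ∃ λ π0 → ∃ λ xN → ∃ λ ρ* → stage1 B f k W C Sα Sβ m ≡ just (Sα* , π0 ++ xN ∷ ρ* , suc xN , xN) ×
     Stage1OutL B W m0 C Sα* π0 xN ρ*
stage1-k<w B cp k W C m0 klt zero m Sα Sβ π ρ inv fu = ⊥-elim (fuel-cannot-run-out W (length π) (length ρ) (Stage1Inv.lenπ inv) (Stage1Inv.lenρ inv) fu)
stage1-k<w B cp k W C m0 klt (suc f) m Sα Sβ π ρ inv fu with Stage1Inv.eqJ inv
... | refl = go GS.outcome where
  Gα = embedα C Sα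
  Gβ = embedβ C (π ++ ρ)
  col = colorAt B Gα Gβ
  module G = Stage1Facts col W m0 m Gα Gβ Sα π ρ inv
  insEq : insertBeforeFirst (blocked B C Sα (π ++ ρ)) m (π ++ ρ) ≡ π ++ m ∷ ρ
  insEq = G.traversal-inserts-between (ltB Gα Gβ) Sα G.ItoJ G.JtoI (ltB-α {Gα} {Gβ}) (ltB-β {Gα} {Gβ}) (ltB-intro {Gα} {Gβ})
  Gα' = embedα C (Sα ++ m ∷ [])
  Gβ' = embedβ C (π ++ m ∷ ρ)
  col' = colorAt B Gα' Gβ'
  stI = IsOrderOn-snoc (preα C) Sα (sufα C) m (Stage1Inv.okI inv)
  stJ = IsOrderOn-insert (preβ C) π ρ (sufβ C) m (Stage1Inv.okJ inv)
  colours-stable : ∀ x → x < m → col x ≡ col' x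
  colours-stable x x<m = colorAt-⊆ B Gα Gβ Gα' Gβ' x (proj₂ stI) (proj₂ stJ) (proj₁ (proj₁ stI)) (proj₁ (proj₁ stJ))
    λ a a≤x → proj₂ (proj₂ (Stage1Inv.okI inv) a) (≤-<-trans a≤x x<m) , proj₂ (proj₂ (Stage1Inv.okJ inv) a) (≤-<-trans a≤x x<m)
  module GS = Stage1Round col col' W m0 m (preα C) (sufα C) (preβ C) (sufβ C) Sα π ρ inv (ltB Gα' Gβ')
    (ltB-α {Gα'} {Gβ'}) (ltB-β {Gα'} {Gβ'})
    (λ a b a< b< ne ce → sameColour⇒comparable B cp {Gα'} {Gβ'} (proj₁ (proj₁ stI)) a< b< ne ce)
    colours-stable (Sα ++ m ∷ []) (λ x q → q) (λ x q → q)
  st : stage1 B (suc f) k W C Sα (π ++ ρ) m ≡ stage1-round-k<w B f k W C Sα m (π ++ m ∷ ρ)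
  st = trans (stage1-unfold-k<w B f k W C Sα (π ++ ρ) m klt) (cong (stage1-round-k<w B f k W C Sα m) insEq)
  go : GS.Outcome → _
  go (inj₁ (le , out)) = Sα ++ m ∷ [] , π , m , ρ ,
    trans st (if-true _ _ (≤ᵇ-true W _ le)) , out
  go (inj₂ (π' , ρ' , lt , inv' , leq)) with stage1-k<w B cp k W C m0 klt f (suc m) (Sα ++ m ∷ []) (π ++ m ∷ ρ) π' ρ' inv'
         (fuel-step W f (length π + length ρ) (length π' + length ρ') fu leq)
  ... | Sα* , π0 , xN , ρ* , e , out = Sα* , π0 , xN , ρ* , trans st (trans (if-false _ _ (≤ᵇ-false W _ lt)) e) , out

Stage1OutE : OnlineAlg → ℕ → ℕ → Ctx → List ℕ → List ℕ → ℕ → List ℕ → Set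
Stage1OutE B W m0 C Sβ π0 xN ρ = Stage1Out (colorAt B (embedα C (π0 ++ xN ∷ ρ)) (embedβ C Sβ)) W m0 (embedβ C Sβ) (embedα C (π0 ++ xN ∷ ρ)) Sβ π0 xN ρ

stage1-k≡w : ∀ B → IsChainPartitioner B → ∀ k W C m0 → (k <ᵇ W) ≡ false → ∀ f m Sα Sβ π ρ →
  Stage1Inv (colorAt B (embedα C Sα) (embedβ C Sβ)) W m0 m (embedβ C Sβ) (embedα C Sα) Sβ Sα π ρ →
  W + W ≤ suc (f + (length π + length ρ)) →
  ∃ λ Sβ* → ∃ λ π0 → ∃ λ xN → ∃ λ ρ* → stage1 B f k W C Sα Sβ m ≡ just (π0 ++ xN ∷ ρ* , Sβ* , suc xN , xN) ×
     Stage1OutE B W m0 C Sβ* π0 xN ρ*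
stage1-k≡w B cp k W C m0 kge zero m Sα Sβ π ρ inv fu = ⊥-elim (fuel-cannot-run-out W (length π) (length ρ) (Stage1Inv.lenπ inv) (Stage1Inv.lenρ inv) fu)
stage1-k≡w B cp k W C m0 kge (suc f) m Sα Sβ π ρ inv fu with Stage1Inv.eqJ inv
... | refl = go GS.outcome where
  Gα = embedα C (π ++ ρ)
  Gβ = embedβ C Sβ
  col = colorAt B Gα Gβ
  module G = Stage1Facts col W m0 m Gβ Gα Sβ π ρ inv
  insEq : insertBeforeFirst (blocked B C (π ++ ρ) Sβ) m (π ++ ρ) ≡ π ++ m ∷ ρ
  insEq = G.traversal-inserts-between (ltB Gα Gβ) (π ++ ρ) (λ z q → q) (λ z q → q) (ltB-β {Gα} {Gβ}) (ltB-α {Gα} {Gβ})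
    (λ p q → ltB-intro {Gα} {Gβ} q p)
  Gα' = embedα C (π ++ m ∷ ρ)
  Gβ' = embedβ C (Sβ ++ m ∷ [])
  col' = colorAt B Gα' Gβ'
  stI = IsOrderOn-snoc (preβ C) Sβ (sufβ C) m (Stage1Inv.okI inv)
  stJ = IsOrderOn-insert (preα C) π ρ (sufα C) m (Stage1Inv.okJ inv)
  colours-stable : ∀ x → x < m → col x ≡ col' x
  colours-stable x x<m = colorAt-⊆ B Gα Gβ Gα' Gβ' x (proj₂ stJ) (proj₂ stI) (proj₁ (proj₁ stJ)) (proj₁ (proj₁ stI))
    λ a a≤x → proj₂ (proj₂ (Stage1Inv.okJ inv) a) (≤-<-trans a≤x x<m) , proj₂ (proj₂ (Stage1Inv.okI inv) a) (≤-<-trans a≤x x<m)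
  memI' = SpansRange-snoc Sβ (Stage1Inv.m0≤m inv) (Stage1Inv.memI inv)
  memJ' = SpansRange-insert π ρ (Stage1Inv.m0≤m inv) (Stage1Inv.memJ inv)
  module GS = Stage1Round col col' W m0 m (preβ C) (sufβ C) (preα C) (sufα C) Sβ π ρ inv (ltB Gα' Gβ')
    (ltB-β {Gα'} {Gβ'}) (ltB-α {Gα'} {Gβ'})
    (λ a b a< b< ne ce → sameColour⇒comparable B cp {Gα'} {Gβ'} (proj₁ (proj₁ stJ)) a< b< ne ce)
    colours-stable (π ++ m ∷ ρ) (λ x q → proj₂ (memI' x) (proj₁ (memJ' x) q)) (λ x q → proj₂ (memJ' x) (proj₁ (memI' x) q))
  st : stage1 B (suc f) k W C (π ++ ρ) Sβ m ≡ stage1-round-k≡w B f k W C Sβ m (π ++ m ∷ ρ)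
  st = trans (stage1-unfold-k≡w B f k W C (π ++ ρ) Sβ m kge) (cong (stage1-round-k≡w B f k W C Sβ m) insEq)
  go : GS.Outcome → _
  go (inj₁ (le , out)) = Sβ ++ m ∷ [] , π , m , ρ ,
    trans st (if-true _ _ (≤ᵇ-true W _ le)) , out
  go (inj₂ (π' , ρ' , lt , inv' , leq)) with stage1-k≡w B cp k W C m0 kge f (suc m) (π ++ m ∷ ρ) (Sβ ++ m ∷ []) π' ρ' inv'
         (fuel-step W f (length π + length ρ) (length π' + length ρ') fu leq)
  ... | Sβ* , π0 , xN , ρ* , e , out = Sβ* , π0 , xN , ρ* , trans st (trans (if-false _ _ (≤ᵇ-false W _ lt)) e) , out

-- Rainbows

IsRainbow : OnlineAlg → List ℕ → List ℕ → (n w : ℕ) → (Fin w → List ℕ) → Set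
IsRainbow B α β n w C =
  (∀ i x → x ∈ C i → x < n) ×
  (∀ i x y → x ∈ C i → y ∈ C i → x ≢ y → LtP α β x y ⊎ LtP α β y x) ×
  (∀ i j x y → i ≢ j → x ∈ C i → y ∈ C j → Incomparable α β x y) ×
  (∀ i j x y → x ∈ C i → y ∈ C j → x ≢ y →
     colorAt B α β x ≢ colorAt B α β y) ×
  (∀ i → Unique (C i) × length (C i) ≡ suc (toℕ i)) ×
  (∀ i x y → x ∈ C i → y < n → LtP α β y x → ∃ λ j → y ∈ C j)

RainbowAbove : OnlineAlg → List ℕ → List ℕ → (n w m : ℕ) → Set
RainbowAbove B α β n w m = Σ (Fin w → List ℕ) λ Ch → IsRainbow B α β n w Ch × (∀ i x → x ∈ Ch i → m ≤ x)

snocChain : ∀ W → (Fin W → List ℕ) → List ℕ → Fin (suc W) → List ℕ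
snocChain zero Ch A _ = A
snocChain (suc W) Ch A Fin.zero = Ch Fin.zero
snocChain (suc W) Ch A (Fin.suc i) = snocChain W (λ j → Ch (Fin.suc j)) A i

snocChain-last : ∀ W Ch A → snocChain W Ch A (fromℕ W) ≡ A
snocChain-last zero Ch A = refl
snocChain-last (suc W) Ch A = snocChain-last W _ A

snocChain-inject₁ : ∀ W Ch A (j : Fin W) → snocChain W Ch A (inject₁ j) ≡ Ch j
snocChain-inject₁ (suc W) Ch A Fin.zero = refl
snocChain-inject₁ (suc W) Ch A (Fin.suc j) = snocChain-inject₁ W _ A j

snocChain-view : ∀ W Ch A (i : Fin (suc W)) → (snocChain W Ch A i ≡ A × toℕ i ≡ W) ⊎ (Σ (Fin W) λ j → snocChain W Ch A i ≡ Ch j × toℕ i ≡ toℕ j)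
snocChain-view zero Ch A Fin.zero = inj₁ (refl , refl)
snocChain-view (suc W) Ch A Fin.zero = inj₂ (Fin.zero , refl , refl)
snocChain-view (suc W) Ch A (Fin.suc i) with snocChain-view W (λ j → Ch (Fin.suc j)) A i
... | inj₁ (e , t) = inj₁ (e , cong suc t)
... | inj₂ (j , e , t) = inj₂ (Fin.suc j , e , cong suc t)

record TopChain (B : OnlineAlg) (Fα Fβ : List ℕ) (n m m1 W' : ℕ) (A : List ℕ) : Set where
  field
    uA : Unique A
    lenA : length A ≡ suc W'
    rngA : ∀ x → x ∈ A → m ≤ x × x < m1
    chainA : ∀ x y → x ∈ A → y ∈ A → x ≢ y → LtP Fα Fβ x y ⊎ LtP Fα Fβ y x
    colA : ∀ x y → x ∈ A → y ∈ A → x ≢ y → colorAt B Fα Fβ x ≢ colorAt B Fα Fβ y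
    incA : ∀ x → x ∈ A → ∀ r → m1 ≤ r → r < n → ltB Fα Fβ x r ≡ false × ltB Fα Fβ r x ≡ false
    downA : ∀ x → x ∈ A → ∀ y → y < n → LtP Fα Fβ y x → y ∈ A

rainbow-snoc : ∀ B → IsChainPartitioner B → ∀ {Fα Fβ n m m1 W'} → Unique Fα → m ≤ m1 → m1 ≤ n →
  (Ch : Fin W' → List ℕ) → IsRainbow B Fα Fβ n W' Ch → (∀ i x → x ∈ Ch i → m1 ≤ x) →
  (A : List ℕ) → TopChain B Fα Fβ n m m1 W' A → RainbowAbove B Fα Fβ n (suc W') m
rainbow-snoc B cp {Fα} {Fβ} {n} {m} {m1} {W'} uα m≤m1 m1≤n Ch
  (old<n , oldChain , oldIncomp , oldColours , oldSizes , oldDown) old≥m1 A top =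
  Ch' , (<n , chain , incomp , colours , sizes , down) , ≥m where
  open TopChain top
  Ch' = snocChain W' Ch A
  ∈-Ch' : ∀ {i x} → x ∈ Ch' i → (x ∈ A × toℕ i ≡ W') ⊎ (Σ (Fin W') λ j → x ∈ Ch j × toℕ i ≡ toℕ j)
  ∈-Ch' {i} q with snocChain-view W' Ch A i
  ... | inj₁ (e , t) = inj₁ (subst (_ ∈_) e q , t)
  ... | inj₂ (j , e , t) = inj₂ (j , subst (_ ∈_) e q , t)
  A<n : ∀ x → x ∈ A → x < n
  A<n x q = <-≤-trans (proj₂ (rngA x q)) m1≤n
  A-incomparable-old : ∀ x y → x ∈ A → ∀ j → y ∈ Ch j → Incomparable Fα Fβ x y
  A-incomparable-old x y xA j yj =
    (λ e → <-irrefl e (<-≤-trans (proj₂ (rngA x xA)) (old≥m1 j y yj))) , incA x xA y (old≥m1 j y yj) (old<n j y yj)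
  <n : ∀ i x → x ∈ Ch' i → x < n
  <n i x q with ∈-Ch' {i} q
  ... | inj₁ (xA , _) = A<n x xA
  ... | inj₂ (j , xj , _) = old<n j x xj
  chain : ∀ i x y → x ∈ Ch' i → y ∈ Ch' i → x ≢ y → LtP Fα Fβ x y ⊎ LtP Fα Fβ y x
  chain i x y xq yq x≢y with snocChain-view W' Ch A i
  ... | inj₁ (e , _) = chainA x y (subst (_ ∈_) e xq) (subst (_ ∈_) e yq) x≢y
  ... | inj₂ (j , e , _) = oldChain j x y (subst (_ ∈_) e xq) (subst (_ ∈_) e yq) x≢y
  incomp : ∀ i j x y → i ≢ j → x ∈ Ch' i → y ∈ Ch' j → Incomparable Fα Fβ x y
  incomp i j x y i≢j xq yq with ∈-Ch' {i} xq | ∈-Ch' {j} yq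
  ... | inj₁ (_ , ti) | inj₁ (_ , tj) = ⊥-elim (i≢j (toℕ-injective (trans ti (sym tj))))
  ... | inj₁ (xA , _) | inj₂ (j' , yj , _) = A-incomparable-old x y xA j' yj
  ... | inj₂ (i' , xi , _) | inj₁ (yA , _) = Incomparable-sym {Fα} {Fβ} (A-incomparable-old y x yA i' xi)
  ... | inj₂ (i' , xi , ti) | inj₂ (j' , yj , tj) =
    oldIncomp i' j' x y (λ e → i≢j (toℕ-injective (trans ti (trans (cong toℕ e) (sym tj))))) xi yj
  colours : ∀ i j x y → x ∈ Ch' i → y ∈ Ch' j → x ≢ y → colorAt B Fα Fβ x ≢ colorAt B Fα Fβ y
  colours i j x y xq yq x≢y with ∈-Ch' {i} xq | ∈-Ch' {j} yq
  ... | inj₁ (xA , _) | inj₁ (yA , _) = colA x y xA yA x≢y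
  ... | inj₁ (xA , _) | inj₂ (j' , yj , _) =
    incomparable⇒differentColours B cp {Fα} {Fβ} uα (A<n x xA) (old<n j' y yj) (A-incomparable-old x y xA j' yj)
  ... | inj₂ (i' , xi , _) | inj₁ (yA , _) =
    incomparable⇒differentColours B cp {Fα} {Fβ} uα (old<n i' x xi) (A<n y yA) (Incomparable-sym {Fα} {Fβ} (A-incomparable-old y x yA i' xi))
  ... | inj₂ (i' , xi , _) | inj₂ (j' , yj , _) = oldColours i' j' x y xi yj x≢y
  sizes : ∀ i → Unique (Ch' i) × length (Ch' i) ≡ suc (toℕ i)
  sizes i with snocChain-view W' Ch A i
  ... | inj₁ (e , t) rewrite e | t = uA , lenA
  ... | inj₂ (j , e , t) rewrite e | t = oldSizes j
  down : ∀ i x y → x ∈ Ch' i → y < n → LtP Fα Fβ y x → ∃ λ j → y ∈ Ch' j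
  down i x y xq y<n y<x with ∈-Ch' {i} xq
  ... | inj₁ (xA , _) = fromℕ W' , subst (y ∈_) (sym (snocChain-last W' Ch A)) (downA x xA y y<n y<x)
  ... | inj₂ (j , xj , _) with oldDown j x y xj y<n y<x
  ...   | j′ , yj′ = inject₁ j′ , subst (y ∈_) (sym (snocChain-inject₁ W' Ch A j′)) yj′
  ≥m : ∀ i x → x ∈ Ch' i → m ≤ x
  ≥m i x q with ∈-Ch' {i} q
  ... | inj₁ (xA , _) = proj₁ (rngA x xA)
  ... | inj₂ (j , xj , _) = ≤-trans m≤m1 (old≥m1 j x xj)

-- Stage 2 and the induction over calls

-- After Stage 2 the order I reads pI ++ cI ++ SI ++ sI and the order J reads
-- pJ ++ A ++ cJ ++ ρ ++ sJ, where cI, cJ are the blocks of the recursive call.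
module Stage1TopChain (B : OnlineAlg) (Fα Fβ : List ℕ) (m xN n W' : ℕ) (pI cI SI sI pJ A cJ ρ sJ : List ℕ)
  (okI : IsOrderOn n (pI ++ cI ++ (SI ++ sI)))
  (okJ : IsOrderOn n ((pJ ++ A) ++ cJ ++ (ρ ++ sJ)))
  (preI : IsOrderOn m (pI ++ sI)) (preJ : IsOrderOn m (pJ ++ sJ))
  (disj : ∀ x → x ∈ pI → x ∈ pJ → ⊥)
  (m≤xN : m ≤ xN)
  (memSI : ∀ x → x ∈ SI → x < suc xN)
  (memA : ∀ x → x ∈ A → m ≤ x × x < suc xN)
  (AinSI : ∀ x → x ∈ A → x ∈ SI)
  (incSI : AllPairs _<_ SI) (incA' : AllPairs _<_ A)
  (lenA' : length A ≡ suc W')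
  (distA : ∀ a b → a ∈ A → b ∈ A → colorAt B Fα Fβ a ≡ colorAt B Fα Fβ b → a ≡ b)
  (ltI : ∀ {z y} → ltB Fα Fβ z y ≡ true → before (pI ++ cI ++ (SI ++ sI)) z y ≡ true)
  (ltJ : ∀ {z y} → ltB Fα Fβ z y ≡ true → before ((pJ ++ A) ++ cJ ++ (ρ ++ sJ)) z y ≡ true)
  (ltmk : ∀ {z y} → before (pI ++ cI ++ (SI ++ sI)) z y ≡ true → before ((pJ ++ A) ++ cJ ++ (ρ ++ sJ)) z y ≡ true → ltB Fα Fβ z y ≡ true)
  (fI : ∀ {z y} → before (pI ++ cI ++ (SI ++ sI)) z y ≡ false → ltB Fα Fβ z y ≡ false)
  (fJ : ∀ {z y} → before ((pJ ++ A) ++ cJ ++ (ρ ++ sJ)) z y ≡ false → ltB Fα Fβ z y ≡ false)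
  where
  FI = pI ++ cI ++ (SI ++ sI)
  FJ = (pJ ++ A) ++ cJ ++ (ρ ++ sJ)
  uI = proj₁ okI
  uJ = proj₁ okJ
  SIsub : SI ⊆ FI
  SIsub = ++⁺ˡ pI (⊆-middle cI SI sI)
  Asub : A ⊆ FJ
  Asub = ++⁺ʳ _ (++⁺ˡ pJ ⊆-refl)
  eqI1 : FI ≡ (pI ++ cI) ++ (SI ++ sI)
  eqI1 = sym (++-assoc pI cI (SI ++ sI))
  eqI2 : FI ≡ (pI ++ cI ++ SI) ++ sI
  eqI2 = trans (cong (pI ++_) (sym (++-assoc cI SI sI))) (sym (++-assoc pI (cI ++ SI) sI))
  sI<m : ∀ x → x ∈ sI → x < m
  sI<m x q = proj₁ (proj₂ preI x) (∈-++⁺ʳ pI q)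
  pJ<m : ∀ x → x ∈ pJ → x < m
  pJ<m x q = proj₁ (proj₂ preJ x) (∈-++⁺ˡ q)
  lt-xN : ∀ {x} → x < m → x < suc xN
  lt-xN x<m = ≤-trans x<m (≤-trans m≤xN (n≤1+n _))
  noRefl : ∀ {x} → x < suc xN → suc xN ≤ x → ⊥
  noRefl a b = <-irrefl refl (<-≤-trans a b)

  chainA : ∀ x y → x ∈ A → y ∈ A → x ≢ y → LtP Fα Fβ x y ⊎ LtP Fα Fβ y x
  chainA x y xA yA ne with <-cmp x y
  ... | tri< a _ _ = inj₁ (ltmk (increasing⇒before-⊆ SIsub uI incSI (AinSI x xA) (AinSI y yA) a) (increasing⇒before-⊆ Asub uJ incA' xA yA a))
  ... | tri≈ _ e _ = ⊥-elim (ne e)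
  ... | tri> _ _ c = inj₂ (ltmk (increasing⇒before-⊆ SIsub uI incSI (AinSI y yA) (AinSI x xA) c) (increasing⇒before-⊆ Asub uJ incA' yA xA c))

  incA : ∀ x → x ∈ A → ∀ r → suc xN ≤ r → r < n → ltB Fα Fβ x r ≡ false × ltB Fα Fβ r x ≡ false
  incA x xA r le r<n = fI bIxr , fJ bJrx where
    rI : r ∈ pI ++ cI
    rI with ∈-++⁻ (pI ++ cI) (subst (r ∈_) eqI1 (proj₂ (proj₂ okI r) r<n))
    ... | inj₁ q = q
    ... | inj₂ q with ∈-++⁻ SI q
    ...   | inj₁ s = ⊥-elim (noRefl (memSI r s) le)
    ...   | inj₂ s = ⊥-elim (noRefl (lt-xN (sI<m r s)) le)
    bIrx : before FI r x ≡ true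
    bIrx = subst (λ L → before L r x ≡ true) (sym eqI1)
      (before-++ (pI ++ cI) (SI ++ sI) (subst Unique eqI1 uI) rI (∈-++⁺ˡ (AinSI x xA)))
    bIxr : before FI x r ≡ false
    bIxr = before-asym FI uI bIrx
    rJ : r ∈ cJ ++ (ρ ++ sJ)
    rJ with ∈-++⁻ (pJ ++ A) (proj₂ (proj₂ okJ r) r<n)
    ... | inj₂ q = q
    ... | inj₁ q with ∈-++⁻ pJ q
    ...   | inj₁ s = ⊥-elim (noRefl (lt-xN (pJ<m r s)) le)
    ...   | inj₂ s = ⊥-elim (noRefl (proj₂ (memA r s)) le)
    bJrx : before FJ r x ≡ false
    bJrx = before-asym FJ uJ (before-++ (pJ ++ A) _ uJ (∈-++⁺ʳ pJ xA) rJ)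

  downA : ∀ x → x ∈ A → ∀ y → y < n → LtP Fα Fβ y x → y ∈ A
  downA x xA y y<n lt with ∈-++⁻ pJ (before-++-left (pJ ++ A) _ uJ (ltJ lt) (∈-++⁺ʳ pJ xA))
  ... | inj₂ yA = yA
  ... | inj₁ ypJ with ∈-++⁻ pI (proj₂ (proj₂ preI y) (pJ<m y ypJ))
  ...   | inj₁ ypI = ⊥-elim (disj y ypI ypJ)
  ...   | inj₂ ysI = ⊥-elim (false≢true (trans (sym (before-asym FI uI xy)) (ltI lt))) where
    xy : before FI x y ≡ true
    xy = subst (λ L → before L x y ≡ true) (sym eqI2)
      (before-++ (pI ++ cI ++ SI) sI (subst Unique eqI2 uI) (∈-++⁺ʳ pI (∈-++⁺ʳ cI (AinSI x xA))) ysI)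

  topChain : TopChain B Fα Fβ n m (suc xN) W' A
  topChain = record
    { uA = increasing⇒Unique incA'
    ; lenA = lenA'
    ; rngA = memA
    ; chainA = chainA
    ; colA = λ x y xA yA ne ce → ne (distA x y xA yA ce)
    ; incA = incA
    ; downA = downA }

stage2-k<w : ∀ k W C Sα Sβ m' xN (rec : ℕ → Ctx → ℕ → Maybe (List ℕ × List ℕ × ℕ)) Aβ Bβ cα cβ m'' →
  splitAfter xN Sβ ≡ (Aβ , Bβ) → (k <ᵇ W) ≡ true →
  rec k (ctx (preα C) (Sα ++ sufα C) (preβ C ++ Aβ) (Bβ ++ sufβ C)) m' ≡ just (cα , cβ , m'') →
  stage2 k W C (Sα , Sβ , m' , xN) rec ≡ just (cα ++ Sα , Aβ ++ cβ ++ Bβ , m'')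
stage2-k<w k W C Sα Sβ m' xN rec Aβ Bβ cα cβ m'' e1 e2 e3 rewrite e1 | e2 | e3 = refl

stage2-k≡w : ∀ k W C Sα Sβ m' xN (rec : ℕ → Ctx → ℕ → Maybe (List ℕ × List ℕ × ℕ)) Aα Bα cα cβ m'' →
  splitAfter xN Sα ≡ (Aα , Bα) → (k <ᵇ W) ≡ false →
  rec (W ∸ 1) (ctx (preα C ++ Aα) (Bα ++ sufα C) (preβ C) (Sβ ++ sufβ C)) m' ≡ just (cα , cβ , m'') →
  stage2 k W C (Sα , Sβ , m' , xN) rec ≡ just (Aα ++ cα ++ Bα , cβ ++ Sβ , m'')
stage2-k≡w k W C Sα Sβ m' xN rec Aα Bα cα cβ m'' e1 e2 e3 rewrite e1 | e2 | e3 = refl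

CallPre : ℕ → Ctx → Set
CallPre m C = IsOrderOn m (preα C ++ sufα C) × IsOrderOn m (preβ C ++ sufβ C) × (∀ x → x ∈ preα C → x ∈ preβ C → ⊥)

CallPost : OnlineAlg → ℕ → ℕ → List ℕ → List ℕ → ℕ → Set
CallPost B m W Fα Fβ n = m ≤ n × IsOrderOn n Fα × IsOrderOn n Fβ × RainbowAbove B Fα Fβ n W m

fuel-shrink : ∀ w f → suc (suc w) + suc (suc w) ≤ f → suc w + suc w ≤ f
fuel-shrink w f le = ≤-trans (+-mono-≤ (n≤1+n (suc w)) (n≤1+n (suc w))) le

stage1Inv-initial : ∀ (col : ℕ → ℕ) W m GI GJ → IsOrderOn m GI → IsOrderOn m GJ → 1 ≤ W →
  Stage1Inv col W m m GI GJ [] [] [] []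
stage1Inv-initial col W m GI GJ okI okJ W≥1 = record
  { eqJ = refl ; m0≤m = ≤-refl ; okI = okI ; okJ = okJ ; memI = mr ; memJ = mr ; subI = minimum GI ; subJ = minimum GJ
  ; incI = [] ; incπ = [] ; decρ = [] ; dist = λ a b () ; cov = λ y () ; lenπ = W≥1 ; lenρ = z≤n }
  where
  mr : SpansRange m m []
  mr x = (λ ()) , λ { (a , b) → ⊥-elim (<-irrefl refl (≤-<-trans a b)) }

CallResult : OnlineAlg → ℕ → ℕ → Ctx → ℕ → ℕ → Set
CallResult B w k C m f = ∃ λ bα → ∃ λ bβ → ∃ λ n → call B f k (suc w) C m ≡ just (bα , bβ , n) ×
   CallPost B m (suc w) (preα C ++ bα ++ sufα C) (preβ C ++ bβ ++ sufβ C) n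

CallsCorrect : OnlineAlg → ℕ → Set
CallsCorrect B w = ∀ k C m f → suc w + suc w ≤ f → CallPre m C → CallResult B w k C m f

fuel-initial : ∀ W f → W + W ≤ f → W + W ≤ suc (f + (length {A = ℕ} [] + length {A = ℕ} []))
fuel-initial W f le = subst (λ t → W + W ≤ suc t) (sym (+-identityʳ f)) (≤-trans le (n≤1+n f))

call-w≡1 : ∀ B → IsChainPartitioner B → CallsCorrect B zero
call-w≡1 B cp k C m f fu (okα , okβ , disj) = m ∷ [] , m ∷ [] , suc m , refl , (n≤1+n m , okα′ , okβ′ , singleton) where
  Fα = preα C ++ (m ∷ []) ++ sufα C
  Fβ = preβ C ++ (m ∷ []) ++ sufβ C
  okα′ : IsOrderOn (suc m) Fα
  okα′ = proj₁ (IsOrderOn-insert (preα C) [] [] (sufα C) m okα)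
  okβ′ : IsOrderOn (suc m) Fβ
  okβ′ = proj₁ (IsOrderOn-insert (preβ C) [] [] (sufβ C) m okβ)
  Ch : Fin 1 → List ℕ
  Ch _ = m ∷ []
  <n : ∀ i x → x ∈ Ch i → x < suc m
  <n i x (here refl) = ≤-refl
  chain : ∀ i x y → x ∈ Ch i → y ∈ Ch i → x ≢ y → LtP Fα Fβ x y ⊎ LtP Fα Fβ y x
  chain i x y (here refl) (here refl) ne = ⊥-elim (ne refl)
  incomp : ∀ i j x y → i ≢ j → x ∈ Ch i → y ∈ Ch j → Incomparable Fα Fβ x y
  incomp Fin.zero Fin.zero x y ne _ _ = ⊥-elim (ne refl)
  colours : ∀ i j x y → x ∈ Ch i → y ∈ Ch j → x ≢ y → colorAt B Fα Fβ x ≢ colorAt B Fα Fβ y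
  colours i j x y (here refl) (here refl) ne = ⊥-elim (ne refl)
  sizes : ∀ i → Unique (Ch i) × length (Ch i) ≡ suc (toℕ i)
  sizes Fin.zero = ([] ∷ []) , refl
  down : ∀ i x y → x ∈ Ch i → y < suc m → LtP Fα Fβ y x → ∃ λ j → y ∈ Ch j
  down i x y (here refl) y< lt with before-middle-block (preα C) (m ∷ []) (sufα C) (proj₁ okα′) (ltB-α {Fα} {Fβ} lt) (here refl)
     | before-middle-block (preβ C) (m ∷ []) (sufβ C) (proj₁ okβ′) (ltB-β {Fα} {Fβ} lt) (here refl)
  ... | inj₂ (here refl) | _ = ⊥-elim (false≢true (trans (sym (ltB-irrefl {Fα} {Fβ} (proj₁ okα′))) lt))
  ... | inj₁ _ | inj₂ (here refl) = ⊥-elim (false≢true (trans (sym (ltB-irrefl {Fα} {Fβ} (proj₁ okα′))) lt))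
  ... | inj₁ a | inj₁ b = ⊥-elim (disj y a b)
  ≥m : ∀ i x → x ∈ Ch i → m ≤ x
  ≥m i x (here refl) = ≤-refl
  singleton : RainbowAbove B Fα Fβ (suc m) 1 m
  singleton = Ch , (<n , chain , incomp , colours , sizes , down) , ≥m

call-k<w : ∀ B → IsChainPartitioner B → ∀ w' k C m f → suc (suc w') + suc (suc w') ≤ f → CallPre m C →
  (k <ᵇ suc (suc w')) ≡ true → CallsCorrect B w' → CallResult B (suc w') k C m f
call-k<w B cp w' k C m f fu (okα , okβ , disj) klt IH
  with stage1-k<w B cp k (suc (suc w')) C m klt f m [] [] [] []
         (stage1Inv-initial (colorAt B (embedα C []) (embedβ C [])) (suc (suc w')) m (embedα C []) (embedβ C []) okα okβ (s≤s z≤n))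
         (fuel-initial (suc (suc w')) f fu)
... | Sα* , π0 , xN , ρ* , e1 , out = go (IH k C' (suc xN) f (fuel-shrink w' f fu) pre') where
  W = suc (suc w')
  pa = preα C
  sa = sufα C
  pb = preβ C
  sb = sufβ C
  A = π0 ++ xN ∷ []
  module O = Stage1Out out
  uJS : Unique (π0 ++ xN ∷ ρ*)
  uJS = Unique-resp-⊇ (⊆-middle pb _ sb) (proj₁ O.okJ)
  split : splitAfter xN (π0 ++ xN ∷ ρ*) ≡ (A , ρ*)
  split = splitAfter-++ xN π0 ρ* (Unique-middle⇒∉ π0 ρ* uJS)
  C' = ctx pa (Sα* ++ sa) (pb ++ A) (ρ* ++ sb)
  pα<m : ∀ x → x ∈ pa → x < m
  pα<m x q = proj₁ (proj₂ okα x) (∈-++⁺ˡ q)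
  memA : ∀ x → x ∈ A → m ≤ x × x < suc xN
  memA x q = proj₁ (O.memJ x) (∈-prefix-extend π0 xN ρ* q)
  disj' : ∀ x → x ∈ pa → x ∈ pb ++ A → ⊥
  disj' x xa xq with ∈-++⁻ pb xq
  ... | inj₁ q = disj x xa q
  ... | inj₂ q = <-irrefl refl (<-≤-trans (pα<m x xa) (proj₁ (memA x q)))
  pre' : CallPre (suc xN) C'
  pre' = O.okI , subst (IsOrderOn (suc xN)) (++-regroup-middle pb π0 xN ρ* sb) O.okJ , disj'
  rec = λ k' C' m' → call B f k' (suc w') C' m'
  go : CallResult B w' k C' (suc xN) f → CallResult B (suc w') k C m f
  go (cα , cβ , n , e3 , (le1 , okαF , okβF , (Ch , body , low))) =
    cα ++ Sα* , A ++ cβ ++ ρ* , n , e2 ,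
    subst₂ (λ X Y → CallPost B m W X Y n) (sym (++-regroup-blockα pa cα Sα* sa)) (sym (++-regroup-blockβ pb A cβ ρ* sb)) postIH
    where
    e2 : call B f k W C m ≡ just (cα ++ Sα* , A ++ cβ ++ ρ* , n)
    e2 = trans (cong (Data.Maybe._>>= (λ r → stage2 k W C r rec)) e1)
               (stage2-k<w k W C Sα* (π0 ++ xN ∷ ρ*) (suc xN) xN rec A ρ* cα cβ n split klt e3)
    FαI = pa ++ cα ++ (Sα* ++ sa)
    FβI = (pb ++ A) ++ cβ ++ (ρ* ++ sb)
    m≤s : m ≤ suc xN
    m≤s = ≤-trans O.m0≤xN (n≤1+n xN)
    subα : (pa ++ Sα* ++ sa) ⊆ FαI
    subα = ⊆-infix pa cα (Sα* ++ sa)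
    subβ : (pb ++ (π0 ++ xN ∷ ρ*) ++ sb) ⊆ FβI
    subβ = subst (_⊆ FβI) (sym (++-regroup-middle pb π0 xN ρ* sb)) (⊆-infix (pb ++ A) cβ (ρ* ++ sb))
    colours-stable : ∀ a → a < suc xN → colorAt B (embedα C Sα*) (embedβ C (π0 ++ xN ∷ ρ*)) a ≡ colorAt B FαI FβI a
    colours-stable a a< = colorAt-⊆ B _ _ FαI FβI a subα subβ (proj₁ okαF) (proj₁ okβF)
      λ a' a'≤ → proj₂ (proj₂ O.okI a') (≤-<-trans a'≤ a<) , proj₂ (proj₂ O.okJ a') (≤-<-trans a'≤ a<)
    distA : ∀ a b → a ∈ A → b ∈ A → colorAt B FαI FβI a ≡ colorAt B FαI FβI b → a ≡ b
    distA a b aA bA ce = O.dist a b aA bA (trans (colours-stable a (proj₂ (memA a aA))) (trans ce (sym (colours-stable b (proj₂ (memA b bA))))))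
    topChain : TopChain B FαI FβI n m (suc xN) (suc w') A
    topChain = Stage1TopChain.topChain B FαI FβI m xN n (suc w') pa cα Sα* sa pb A cβ ρ* sb okαF okβF okα okβ disj O.m0≤xN
      (λ x q → proj₂ (proj₁ (O.memI x) q)) memA
      (λ x q → proj₂ (O.memI x) (proj₁ (O.memJ x) (∈-prefix-extend π0 xN ρ* q)))
      O.incI O.incπ O.len distA
      (ltB-α {FαI} {FβI}) (ltB-β {FαI} {FβI}) (ltB-intro {FαI} {FβI}) (ltB-falseα {FαI} {FβI}) (ltB-falseβ {FαI} {FβI})
    postIH : CallPost B m W FαI FβI n
    postIH = ≤-trans m≤s le1 , okαF , okβF , rainbow-snoc B cp (proj₁ okαF) m≤s le1 Ch body low A topChain

call-k≡w : ∀ B → IsChainPartitioner B → ∀ w' k C m f → suc (suc w') + suc (suc w') ≤ f → CallPre m C →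
  (k <ᵇ suc (suc w')) ≡ false → CallsCorrect B w' → CallResult B (suc w') k C m f
call-k≡w B cp w' k C m f fu (okα , okβ , disj) kge IH
  with stage1-k≡w B cp k (suc (suc w')) C m kge f m [] [] [] []
         (stage1Inv-initial (colorAt B (embedα C []) (embedβ C [])) (suc (suc w')) m (embedβ C []) (embedα C []) okβ okα (s≤s z≤n))
         (fuel-initial (suc (suc w')) f fu)
... | Sβ* , π0 , xN , ρ* , e1 , out = go (IH (suc w') C' (suc xN) f (fuel-shrink w' f fu) pre') where
  W = suc (suc w')
  pa = preα C
  sa = sufα C
  pb = preβ C
  sb = sufβ C
  A = π0 ++ xN ∷ []
  module O = Stage1Out out
  uJS : Unique (π0 ++ xN ∷ ρ*)
  uJS = Unique-resp-⊇ (⊆-middle pa _ sa) (proj₁ O.okJ)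
  split : splitAfter xN (π0 ++ xN ∷ ρ*) ≡ (A , ρ*)
  split = splitAfter-++ xN π0 ρ* (Unique-middle⇒∉ π0 ρ* uJS)
  C' = ctx (pa ++ A) (ρ* ++ sa) pb (Sβ* ++ sb)
  pβ<m : ∀ x → x ∈ pb → x < m
  pβ<m x q = proj₁ (proj₂ okβ x) (∈-++⁺ˡ q)
  memA : ∀ x → x ∈ A → m ≤ x × x < suc xN
  memA x q = proj₁ (O.memJ x) (∈-prefix-extend π0 xN ρ* q)
  disj' : ∀ x → x ∈ pa ++ A → x ∈ pb → ⊥
  disj' x xq xb with ∈-++⁻ pa xq
  ... | inj₁ q = disj x q xb
  ... | inj₂ q = <-irrefl refl (<-≤-trans (pβ<m x xb) (proj₁ (memA x q)))
  pre' : CallPre (suc xN) C'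
  pre' = subst (IsOrderOn (suc xN)) (++-regroup-middle pa π0 xN ρ* sa) O.okJ , O.okI , disj'
  rec = λ k' C' m' → call B f k' (suc w') C' m'
  go : CallResult B w' (suc w') C' (suc xN) f → CallResult B (suc w') k C m f
  go (cα , cβ , n , e3 , (le1 , okαF , okβF , (Ch , body , low))) =
    A ++ cα ++ ρ* , cβ ++ Sβ* , n , e2 ,
    subst₂ (λ X Y → CallPost B m W X Y n) (sym (++-regroup-blockβ pa A cα ρ* sa)) (sym (++-regroup-blockα pb cβ Sβ* sb)) postIH
    where
    e2 : call B f k W C m ≡ just (A ++ cα ++ ρ* , cβ ++ Sβ* , n)
    e2 = trans (cong (Data.Maybe._>>= (λ r → stage2 k W C r rec)) e1)
               (stage2-k≡w k W C (π0 ++ xN ∷ ρ*) Sβ* (suc xN) xN rec A ρ* cα cβ n split kge e3)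
    FαI = (pa ++ A) ++ cα ++ (ρ* ++ sa)
    FβI = pb ++ cβ ++ (Sβ* ++ sb)
    m≤s : m ≤ suc xN
    m≤s = ≤-trans O.m0≤xN (n≤1+n xN)
    subβ : (pb ++ Sβ* ++ sb) ⊆ FβI
    subβ = ⊆-infix pb cβ (Sβ* ++ sb)
    subα : (pa ++ (π0 ++ xN ∷ ρ*) ++ sa) ⊆ FαI
    subα = subst (_⊆ FαI) (sym (++-regroup-middle pa π0 xN ρ* sa)) (⊆-infix (pa ++ A) cα (ρ* ++ sa))
    colours-stable : ∀ a → a < suc xN → colorAt B (embedα C (π0 ++ xN ∷ ρ*)) (embedβ C Sβ*) a ≡ colorAt B FαI FβI a
    colours-stable a a< = colorAt-⊆ B _ _ FαI FβI a subα subβ (proj₁ okαF) (proj₁ okβF)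
      λ a' a'≤ → proj₂ (proj₂ O.okJ a') (≤-<-trans a'≤ a<) , proj₂ (proj₂ O.okI a') (≤-<-trans a'≤ a<)
    distA : ∀ a b → a ∈ A → b ∈ A → colorAt B FαI FβI a ≡ colorAt B FαI FβI b → a ≡ b
    distA a b aA bA ce = O.dist a b aA bA (trans (colours-stable a (proj₂ (memA a aA))) (trans ce (sym (colours-stable b (proj₂ (memA b bA))))))
    topChain : TopChain B FαI FβI n m (suc xN) (suc w') A
    topChain = Stage1TopChain.topChain B FαI FβI m xN n (suc w') pb cβ Sβ* sb pa A cα ρ* sa okβF okαF okβ okα
      (λ x p q → disj x q p) O.m0≤xN
      (λ x q → proj₂ (proj₁ (O.memI x) q)) memA
      (λ x q → proj₂ (O.memI x) (proj₁ (O.memJ x) (∈-prefix-extend π0 xN ρ* q)))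
      O.incI O.incπ O.len distA
      (ltB-β {FαI} {FβI}) (ltB-α {FαI} {FβI}) (λ p q → ltB-intro {FαI} {FβI} q p) (ltB-falseβ {FαI} {FβI}) (ltB-falseα {FαI} {FβI})
    postIH : CallPost B m W FαI FβI n
    postIH = ≤-trans m≤s le1 , okαF , okβF , rainbow-snoc B cp (proj₁ okαF) m≤s le1 Ch body low A topChain

calls-correct : ∀ B → IsChainPartitioner B → ∀ w → CallsCorrect B w
calls-correct B cp zero = call-w≡1 B cp
calls-correct B cp (suc w') k C m f fu pre = dispatch (k <ᵇ suc (suc w')) refl where
  dispatch : (b : Bool) → (k <ᵇ suc (suc w')) ≡ b → CallResult B (suc w') k C m f
  dispatch true e = call-k<w B cp w' k C m f fu pre e (calls-correct B cp w')
  dispatch false e = call-k≡w B cp w' k C m f fu pre e (calls-correct B cp w')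

callPre-empty : CallPre 0 (ctx [] [] [] [])
callPre-empty = ([] , (λ x → (λ ()) , (λ ()))) , ([] , (λ x → (λ ()) , (λ ()))) , (λ x ())

-- The hypotheses on k only exclude w = 0.
lemma3p3 : (B : OnlineAlg) → IsChainPartitioner B →
    (k w : ℕ) → 1 ≤ k → k ≤ w →
    ∃ λ fuel → ∃ λ (α : List ℕ) → ∃ λ (β : List ℕ) → ∃ λ (n : ℕ) →
    R B fuel k w ≡ just (α , β , n) × Rainbow B α β n w
lemma3p3 B cp k zero (s≤s _) ()
lemma3p3 B cp k (suc w') _ _ with calls-correct B cp w' k (ctx [] [] [] []) 0 (suc w' + suc w') ≤-refl callPre-empty
... | bα , bβ , n , e , (_ , _ , _ , rx) with subst₂ (λ X Y → RainbowAbove B X Y n (suc w') 0) (++-identityʳ bα) (++-identityʳ bβ) rx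
...   | Ch , body , _ = suc w' + suc w' , bα , bβ , n , e , Ch , body
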